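{- Let $m,n$ be positive integers with $m \equiv 0 \pmod 8$ and $n \equiv 0 \pmod 2$. Then $K_m \Box K_n$ has an $L_8$-decomposition.
   Context: $K_m$ is the complete graph on $m$ vertices. The Cartesian product $G \Box H$ has vertex set $V(G)\times V(H)$, with $(g,h)$ adjacent to $(g',h')$ iff either $g=g'$ and $hh'\in E(H)$, or $h=h'$ and $gg'\in E(G)$. The sunlet graph $L_8$ is the graph on 8 vertices $x_1,\dots,x_8$ with edge set $\{x_1x_2,x_2x_3,x_3x_4,x_4x_1,x_1x_5,x_2x_6,x_3x_7,x_4x_8\}$. An $L_8$-decomposition of a graph $G$ is a partition of $E(G)$ into sets each inducing a subgraph isomorphic to $L_8$. -}

module Defs where

open import Data.Nat using (ℕ)
open import Data.Fin using (Fin; zero; suc)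
open import Data.Product using (Σ; _×_; _,_)
open import Data.Sum using (_⊎_; inj₁; inj₂)
open import Data.Empty using (⊥)
open import Relation.Binary.PropositionalEquality using (_≡_; _≢_; refl)
  renaming (sym to ≡-sym)
open import Function.Definitions using (Injective)

-- A simple undirected graph: a vertex type with a symmetric, irreflexive
-- adjacency relation. Edges are the unordered pairs {u,v} with Adj u v.
record Graph : Set₁ where
  field
    V      : Set
    Adj    : V → V → Set
    sym    : ∀ {u v} → Adj u v → Adj v u
    irrefl : ∀ {u} → Adj u u → ⊥
open Graph public

K : ℕ → Graph
K m = record
  { V = Fin m
  ; Adj = λ a b → a ≢ b
  ; sym = λ ne eq → ne (≡-sym eq)
  ; irrefl = λ ne → ne refl
  }

_□_ : Graph → Graph → Graph
G □ H = record
  { V = V G × V H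
  ; Adj = λ { (g , h) (g' , h') → (g ≡ g' × Adj H h h') ⊎ (h ≡ h' × Adj G g g') }
  ; sym = λ { (inj₁ (e , a)) → inj₁ (≡-sym e , Graph.sym H a)
            ; (inj₂ (e , a)) → inj₂ (≡-sym e , Graph.sym G a) }
  ; irrefl = λ { (inj₁ (_ , a)) → Graph.irrefl H a
               ; (inj₂ (_ , a)) → Graph.irrefl G a }
  }

x₁ x₂ x₃ x₄ x₅ x₆ x₇ x₈ : Fin 8
x₁ = zero
x₂ = suc zero
x₃ = suc (suc zero)
x₄ = suc (suc (suc zero))
x₅ = suc (suc (suc (suc zero)))
x₆ = suc (suc (suc (suc (suc zero))))
x₇ = suc (suc (suc (suc (suc (suc zero)))))
x₈ = suc (suc (suc (suc (suc (suc (suc zero))))))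

L8edge : Fin 8 → Fin 8 × Fin 8
L8edge zero                                               = (x₁ , x₂)
L8edge (suc zero)                                         = (x₂ , x₃)
L8edge (suc (suc zero))                                   = (x₃ , x₄)
L8edge (suc (suc (suc zero)))                             = (x₄ , x₁)
L8edge (suc (suc (suc (suc zero))))                       = (x₁ , x₅)
L8edge (suc (suc (suc (suc (suc zero)))))                 = (x₂ , x₆)
L8edge (suc (suc (suc (suc (suc (suc zero))))))           = (x₃ , x₇)
L8edge (suc (suc (suc (suc (suc (suc (suc zero)))))))     = (x₄ , x₈)

record L8Copy (G : Graph) : Set where
  field
    f     : Fin 8 → V G
    inj   : Injective _≡_ _≡_ f
    edges : ∀ e → Adj G (f (Data.Product.proj₁ (L8edge e)))
                          (f (Data.Product.proj₂ (L8edge e)))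
open L8Copy public

Covers : {G : Graph} → L8Copy G → Fin 8 → V G → V G → Set
Covers c e u v with L8edge e
... | (a , b) = (f c a ≡ u × f c b ≡ v) ⊎ (f c a ≡ v × f c b ≡ u)

-- An L_8-decomposition of G: finitely many copies of L_8 in G such that every
-- edge {u,v} of G is the image of exactly one (copy, L_8-edge) pair, i.e. the
-- edge sets of the copies partition E(G).
record L8Decomposition (G : Graph) : Set where
  field
    k      : ℕ
    copies : Fin k → L8Copy G
    unique : ∀ u v → Adj G u v →
             Σ (Fin k × Fin 8) λ { (i , e) →
               Covers (copies i) e u v ×
               (∀ i' e' → Covers (copies i') e' u v → (i' , e') ≡ (i , e)) }

module Submission where

-- We prove a stronger statement: K_{4r} □ K_{2s} has an L_8-decomposition for
-- all r, s ≥ 1 (so 8 ∣ m is only used through 4 ∣ m).  The proof glues small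
-- decompositions together.
--
-- The edges of K_{A⊎B} □ K_n split into a copy of
-- K_A □ K_n, a copy of K_B □ K_n and n copies of the complete bipartite graph
-- K_{A,B} (one per column); the edges of K_{A⊎B,C} split into K_{A,C} and K_{B,C}.
-- The base cases K_4 □ K_2, K_4 □ K_4, K_4 □ K_6, K_4 □ K_10, K_{4,4} and K_{6,8}
-- are explicit decompositions, verified by a decision procedure from a table
-- naming the copy that covers each edge.  Induction then gives K_{2q,8} (q ≥ 2),
-- K_4 □ K_{2s}, K_{4r,4} and finally K_{4r} □ K_{2s}.

open import Defs
open import Data.Nat using (ℕ; zero; suc; _+_; _*_; _<_)
open import Data.Nat.Properties using (*-assoc)
open import Data.Nat.Divisibility using (_∣_; divides)
open import Data.Fin using (Fin; zero; suc; #_; combine; join)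
open import Data.Fin.Properties using (+↔⊎; *↔×; all?) renaming (_≟_ to _≟ᶠ_)
open import Data.Product using (Σ; _×_; _,_; proj₁; proj₂; map₁; map₂; swap; uncurry)
open import Data.Product.Function.NonDependent.Propositional using (_×-↔_)
open import Data.Product.Algebra using (×-comm)
open import Data.Product.Properties using () renaming (≡-dec to ×-≡-dec)
open import Data.Sum using (_⊎_; inj₁; inj₂)
import Data.Sum as Sum using (map₁; swap)
open import Data.Sum.Algebra using (⊎-comm)
open import Data.Sum.Function.Propositional using (_⊎-↔_)
open import Data.Sum.Properties using (inj₁-injective; inj₂-injective) renaming (≡-dec to ⊎-≡-dec)
open import Data.Empty using (⊥; ⊥-elim)
open import Data.Unit using (⊤; tt)
open import Data.Vec using (Vec; _∷_; []; lookup)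
open import Function.Base using (id)
open import Function.Bundles using (_↔_; Inverse)
open import Function.Properties.Inverse using (↔-refl; ↔-sym)
open import Relation.Nullary using (Dec; yes; no)
open import Relation.Nullary.Decidable using (True; toWitness; map′; _×-dec_; _⊎-dec_; _→-dec_; ¬?)
open import Relation.Binary.Definitions using (DecidableEquality)
open import Relation.Binary.PropositionalEquality
  using (_≡_; _≢_; refl; trans; cong; cong₂; subst; subst₂; module ≡-Reasoning)
  renaming (sym to ≡-sym)

src tgt : Fin 8 → Fin 8
src e = proj₁ (L8edge e)
tgt e = proj₂ (L8edge e)

data Cov {G : Graph} (c : L8Copy G) (e : Fin 8) (u v : V G) : Set where
  forward  : f c (src e) ≡ u → f c (tgt e) ≡ v → Cov c e u v
  backward : f c (src e) ≡ v → f c (tgt e) ≡ u → Cov c e u v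

-- Covers from Defs, unfolded so that it computes also when e is a variable.
Covers′ : {G : Graph} → L8Copy G → Fin 8 → V G → V G → Set
Covers′ c e u v = (f c (src e) ≡ u × f c (tgt e) ≡ v) ⊎ (f c (src e) ≡ v × f c (tgt e) ≡ u)

Covers≡Covers′ : {G : Graph} (c : L8Copy G) (e : Fin 8) (u v : V G) → Covers c e u v ≡ Covers′ c e u v
Covers≡Covers′ c zero                                                 u v = refl
Covers≡Covers′ c (suc zero)                                           u v = refl
Covers≡Covers′ c (suc (suc zero))                                     u v = refl
Covers≡Covers′ c (suc (suc (suc zero)))                               u v = refl
Covers≡Covers′ c (suc (suc (suc (suc zero))))                         u v = refl
Covers≡Covers′ c (suc (suc (suc (suc (suc zero)))))                   u v = refl
Covers≡Covers′ c (suc (suc (suc (suc (suc (suc zero))))))             u v = refl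
Covers≡Covers′ c (suc (suc (suc (suc (suc (suc (suc zero)))))))       u v = refl

Covers⇒Cov : {G : Graph} (c : L8Copy G) (e : Fin 8) {u v : V G} → Covers c e u v → Cov c e u v
Covers⇒Cov c e {u} {v} cv with subst id (Covers≡Covers′ c e u v) cv
... | inj₁ (p , q) = forward p q
... | inj₂ (p , q) = backward p q

Cov⇒Covers : {G : Graph} (c : L8Copy G) (e : Fin 8) {u v : V G} → Cov c e u v → Covers c e u v
Cov⇒Covers c e {u} {v} cv = subst id (≡-sym (Covers≡Covers′ c e u v)) (unfold cv)
  where
  unfold : Cov c e u v → Covers′ c e u v
  unfold (forward p q)  = inj₁ (p , q)
  unfold (backward p q) = inj₂ (p , q)

EdgeSet : Graph → Set₁
EdgeSet G = V G → V G → Set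

record EdgeDecomposition (G : Graph) (I : Set) (S : EdgeSet G) : Set where
  field
    copy     : I → L8Copy G
    cover    : ∀ {u v} → S u v → Σ (I × Fin 8) λ ie → Cov (copy (proj₁ ie)) (proj₂ ie) u v
    sound    : ∀ {i e u v} → Cov (copy i) e u v → S u v
    disjoint : ∀ {i e i′ e′ u v} → Cov (copy i) e u v → Cov (copy i′) e′ u v → (i , e) ≡ (i′ , e′)
open EdgeDecomposition

DecomposableOn : (G : Graph) → EdgeSet G → Set
DecomposableOn G S = Σ ℕ λ k → EdgeDecomposition G (Fin k) S

Decomposable : Graph → Set
Decomposable G = DecomposableOn G (Adj G)

toL8Decomposition : {G : Graph} → Decomposable G → L8Decomposition G
toL8Decomposition (k , D) = record
  { k = k
  ; copies = copy D
  ; unique = λ u v uv →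
      let ((i , e) , c) = cover D uv
      in (i , e) , Cov⇒Covers (copy D i) e c , λ i′ e′ c′ → disjoint D (Covers⇒Cov (copy D i′) e′ c′) c
  }

module _ {G : Graph} where

  reindex : {I J : Set} {S : EdgeSet G} → I ↔ J → EdgeDecomposition G I S → EdgeDecomposition G J S
  reindex {J = J} {S = S} ι D = record
    { copy     = λ j → copy D (from j)
    ; cover    = cover′
    ; sound    = sound D
    ; disjoint = disjoint′
    }
    where
    open Inverse ι using (to; from; strictlyInverseˡ; strictlyInverseʳ)
    cover′ : ∀ {u v} → S u v → Σ (J × Fin 8) λ je → Cov (copy D (from (proj₁ je))) (proj₂ je) u v
    cover′ s with cover D s
    ... | (i , e) , c = (to i , e) , subst (λ i′ → Cov (copy D i′) e _ _) (≡-sym (strictlyInverseʳ i)) c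
    disjoint′ : ∀ {j e j′ e′ u v} → Cov (copy D (from j)) e u v → Cov (copy D (from j′)) e′ u v →
                (j , e) ≡ (j′ , e′)
    disjoint′ {j} {e} {j′} {e′} c c′ = begin
      (j , e)                 ≡⟨ cong (_, e) (≡-sym (strictlyInverseˡ j)) ⟩
      (to (from j) , e)       ≡⟨ cong (map₁ to) (disjoint D c c′) ⟩
      (to (from j′) , e′)     ≡⟨ cong (_, e′) (strictlyInverseˡ j′) ⟩
      (j′ , e′)               ∎
      where open ≡-Reasoning

  restate : {I : Set} {S T : EdgeSet G} → (∀ {u v} → T u v → S u v) → (∀ {u v} → S u v → T u v) →
            EdgeDecomposition G I S → EdgeDecomposition G I T
  restate T⇒S S⇒T D = record
    { copy     = copy D
    ; cover    = λ t → cover D (T⇒S t)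
    ; sound    = λ c → S⇒T (sound D c)
    ; disjoint = disjoint D
    }

  union : {I J : Set} {S T : EdgeSet G} → (∀ {u v} → S u v → T u v → ⊥) →
          EdgeDecomposition G I S → EdgeDecomposition G J T →
          EdgeDecomposition G (I ⊎ J) (λ u v → S u v ⊎ T u v)
  union {I} {J} {S} {T} S∩T=∅ D E = record
    { copy     = copy′
    ; cover    = cover′
    ; sound    = λ {i} → sound′ i
    ; disjoint = disjoint′
    }
    where
    copy′ : I ⊎ J → L8Copy G
    copy′ (inj₁ i) = copy D i
    copy′ (inj₂ j) = copy E j
    cover′ : ∀ {u v} → S u v ⊎ T u v → Σ ((I ⊎ J) × Fin 8) λ ie → Cov (copy′ (proj₁ ie)) (proj₂ ie) u v
    cover′ (inj₁ s) = let ((i , e) , c) = cover D s in (inj₁ i , e) , c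
    cover′ (inj₂ t) = let ((j , e) , c) = cover E t in (inj₂ j , e) , c
    sound′ : ∀ i {e u v} → Cov (copy′ i) e u v → S u v ⊎ T u v
    sound′ (inj₁ i) c = inj₁ (sound D c)
    sound′ (inj₂ j) c = inj₂ (sound E c)
    disjoint′ : ∀ {i e i′ e′ u v} → Cov (copy′ i) e u v → Cov (copy′ i′) e′ u v → (i , e) ≡ (i′ , e′)
    disjoint′ {inj₁ i} {i′ = inj₁ i′} c c′ = cong (map₁ inj₁) (disjoint D c c′)
    disjoint′ {inj₁ i} {i′ = inj₂ j′} c c′ = ⊥-elim (S∩T=∅ (sound D c) (sound E c′))
    disjoint′ {inj₂ j} {i′ = inj₁ i′} c c′ = ⊥-elim (S∩T=∅ (sound D c′) (sound E c))
    disjoint′ {inj₂ j} {i′ = inj₂ j′} c c′ = cong (map₁ inj₂) (disjoint E c c′)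

  family : {P I : Set} {S : P → EdgeSet G} → (∀ {p p′ u v} → S p u v → S p′ u v → p ≡ p′) →
           (∀ p → EdgeDecomposition G I (S p)) →
           EdgeDecomposition G (P × I) (λ u v → Σ P λ p → S p u v)
  family separated D = record
    { copy     = λ (p , i) → copy (D p) i
    ; cover    = λ (p , s) → let ((i , e) , c) = cover (D p) s in ((p , i) , e) , c
    ; sound    = λ {pi} c → proj₁ pi , sound (D (proj₁ pi)) c
    ; disjoint = disjoint′
    }
    where
    disjoint′ : ∀ {pi e pi′ e′ u v} → Cov (copy (D (proj₁ pi)) (proj₂ pi)) e u v →
                Cov (copy (D (proj₁ pi′)) (proj₂ pi′)) e′ u v → (pi , e) ≡ (pi′ , e′)
    disjoint′ {p , i} {pi′ = p′ , i′} c c′ with separated (sound (D p) c) (sound (D p′) c′)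
    ... | refl = cong (map₁ (p ,_)) (disjoint (D p) c c′)

  unionᶠ : {S T : EdgeSet G} → (∀ {u v} → S u v → T u v → ⊥) →
           DecomposableOn G S → DecomposableOn G T → DecomposableOn G (λ u v → S u v ⊎ T u v)
  unionᶠ S∩T=∅ (k , D) (l , E) = k + l , reindex (↔-sym +↔⊎) (union S∩T=∅ D E)

  familyᶠ : {k : ℕ} (n : ℕ) {S : Fin n → EdgeSet G} → (∀ {p p′ u v} → S p u v → S p′ u v → p ≡ p′) →
            (∀ p → EdgeDecomposition G (Fin k) (S p)) →
            DecomposableOn G (λ u v → Σ (Fin n) λ p → S p u v)
  familyᶠ {k} n separated D = n * k , reindex (↔-sym *↔×) (family separated D)

record Embedding (H G : Graph) : Set where
  field
    map       : V H → V G
    injective : ∀ {x y} → map x ≡ map y → x ≡ y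
    adjacent  : ∀ {x y} → Adj H x y → Adj G (map x) (map y)
open Embedding

Image : {H G : Graph} → Embedding H G → EdgeSet H → EdgeSet G
Image {H} E S u v = Σ (V H) λ x → Σ (V H) λ y → S x y × map E x ≡ u × map E y ≡ v

image-adjacent : {H G : Graph} (E : Embedding H G) {u v : V G} → Image E (Adj H) u v → Adj G u v
image-adjacent E (x , y , xy , refl , refl) = adjacent E xy

module _ {H G : Graph} (E : Embedding H G) where

  mapCopy : L8Copy H → L8Copy G
  mapCopy c = record
    { f     = λ x → map E (f c x)
    ; inj   = λ eq → inj c (injective E eq)
    ; edges = λ e → adjacent E (edges c e)
    }

  Cov-map : ∀ {c e x y} → Cov c e x y → Cov (mapCopy c) e (map E x) (map E y)
  Cov-map (forward p q)  = forward (cong (map E) p) (cong (map E) q)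
  Cov-map (backward p q) = backward (cong (map E) p) (cong (map E) q)

  Cov-unmap : ∀ {c e x y} → Cov (mapCopy c) e (map E x) (map E y) → Cov c e x y
  Cov-unmap (forward p q)  = forward (injective E p) (injective E q)
  Cov-unmap (backward p q) = backward (injective E p) (injective E q)

  transport : {I : Set} {S : EdgeSet H} → EdgeDecomposition H I S → EdgeDecomposition G I (Image E S)
  transport {S = S} D = record
    { copy     = λ i → mapCopy (copy D i)
    ; cover    = λ { (x , y , s , refl , refl) → let (ie , c) = cover D s in ie , Cov-map c }
    ; sound    = sound′
    ; disjoint = disjoint′
    }
    where
    sound′ : ∀ {i e u v} → Cov (mapCopy (copy D i)) e u v → Image E S u v
    sound′ {i} {e} (forward p q)  = _ , _ , sound D {i} {e} (forward refl refl) , p , q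
    sound′ {i} {e} (backward p q) = _ , _ , sound D {i} {e} (backward refl refl) , q , p
    disjoint′ : ∀ {i e i′ e′ u v} → Cov (mapCopy (copy D i)) e u v → Cov (mapCopy (copy D i′)) e′ u v →
                (i , e) ≡ (i′ , e′)
    disjoint′ (forward refl refl)  c′ = disjoint D (forward refl refl) (Cov-unmap c′)
    disjoint′ (backward refl refl) c′ = disjoint D (backward refl refl) (Cov-unmap c′)

onto : {H G : Graph} (E : Embedding H G) → (∀ {u v} → Adj G u v → Image E (Adj H) u v) →
       Decomposable H → Decomposable G
onto E surjective (k , D) = k , restate surjective (image-adjacent E) (transport E D)

↔-injective : {A B : Set} (ι : A ↔ B) {x y : A} → Inverse.to ι x ≡ Inverse.to ι y → x ≡ y
↔-injective ι {x} {y} eq = begin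
  x                ≡⟨ ≡-sym (strictlyInverseʳ x) ⟩
  from (to x)      ≡⟨ cong from eq ⟩
  from (to y)      ≡⟨ strictlyInverseʳ y ⟩
  y                ∎
  where
  open Inverse ι using (to; from; strictlyInverseʳ)
  open ≡-Reasoning

relabel : {H G : Graph} (ι : V H ↔ V G) →
          (∀ {x y} → Adj H x y → Adj G (Inverse.to ι x) (Inverse.to ι y)) →
          (∀ {x y} → Adj G (Inverse.to ι x) (Inverse.to ι y) → Adj H x y) →
          Decomposable H → Decomposable G
relabel {H} {G} ι preserves reflects = onto embedding surjective
  where
  open Inverse ι using (to; from; strictlyInverseˡ)
  embedding : Embedding H G
  embedding = record
    { map       = to
    ; injective = ↔-injective ι
    ; adjacent  = preserves
    }
  surjective : ∀ {u v} → Adj G u v → Image embedding (Adj H) u v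
  surjective {u} {v} uv =
    from u , from v ,
    reflects (subst₂ (Adj G) (≡-sym (strictlyInverseˡ u)) (≡-sym (strictlyInverseˡ v)) uv) ,
    strictlyInverseˡ u , strictlyInverseˡ v

-- The complete graph on a type; K m is Complete (Fin m) by definition.
Complete : Set → Graph
Complete A = record
  { V      = A
  ; Adj    = λ a b → a ≢ b
  ; sym    = λ a≢b b≡a → a≢b (≡-sym b≡a)
  ; irrefl = λ a≢a → a≢a refl
  }

Rook : Set → Set → Graph
Rook A B = Complete A □ Complete B

Across : {A B : Set} → A ⊎ B → A ⊎ B → Set
Across (inj₁ _) (inj₂ _) = ⊤
Across (inj₂ _) (inj₁ _) = ⊤
Across _        _        = ⊥

Across-sym : {A B : Set} {s t : A ⊎ B} → Across s t → Across t s
Across-sym {s = inj₁ _} {inj₂ _} _ = tt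
Across-sym {s = inj₂ _} {inj₁ _} _ = tt

Across⇒≢ : {A B : Set} {s t : A ⊎ B} → Across s t → s ≢ t
Across⇒≢ {s = inj₁ _} {inj₂ _} _ ()
Across⇒≢ {s = inj₂ _} {inj₁ _} _ ()

Bipartite : Set → Set → Graph
Bipartite A B = record
  { V      = A ⊎ B
  ; Adj    = Across
  ; sym    = Across-sym
  ; irrefl = λ st → Across⇒≢ st refl
  }

rowEmbedding : {A A′ B : Set} (φ : A → A′) → (∀ {a a′} → φ a ≡ φ a′ → a ≡ a′) →
               Embedding (Rook A B) (Rook A′ B)
rowEmbedding φ φ-injective = record
  { map       = map₁ φ
  ; injective = λ { {a , b} {a′ , b′} eq → cong₂ _,_ (φ-injective (cong proj₁ eq)) (cong proj₂ eq) }
  ; adjacent  = λ { (inj₁ (a≡a′ , b≢b′)) → inj₁ (cong φ a≡a′ , b≢b′)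
                  ; (inj₂ (b≡b′ , a≢a′)) → inj₂ (b≡b′ , λ eq → a≢a′ (φ-injective eq)) }
  }

partEmbedding : {A A′ B : Set} (φ : A → A′) → (∀ {a a′} → φ a ≡ φ a′ → a ≡ a′) →
                Embedding (Bipartite A B) (Bipartite A′ B)
partEmbedding {A} {A′} {B} φ φ-injective = record
  { map       = Sum.map₁ φ
  ; injective = injective′
  ; adjacent  = adjacent′
  }
  where
  injective′ : ∀ {s t : A ⊎ B} → Sum.map₁ φ s ≡ Sum.map₁ φ t → s ≡ t
  injective′ {inj₁ a} {inj₁ a′} eq = cong inj₁ (φ-injective (inj₁-injective eq))
  injective′ {inj₂ b} {inj₂ b′} eq = cong inj₂ (inj₂-injective eq)
  adjacent′ : ∀ {s t : A ⊎ B} → Across s t → Across (Sum.map₁ φ s) (Sum.map₁ φ t)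
  adjacent′ {inj₁ _} {inj₂ _} _ = tt
  adjacent′ {inj₂ _} {inj₁ _} _ = tt

module _ {A B : Set} where

  swapRook : Decomposable (Rook A B) → Decomposable (Rook B A)
  swapRook = relabel (×-comm A B) transpose transpose
    where
    transpose : ∀ {A B : Set} {x y : A × B} → Adj (Rook A B) x y → Adj (Rook B A) (swap x) (swap y)
    transpose (inj₁ same-row)    = inj₂ same-row
    transpose (inj₂ same-column) = inj₁ same-column

  swapBipartite : Decomposable (Bipartite A B) → Decomposable (Bipartite B A)
  swapBipartite = relabel (⊎-comm A B) mirror mirror⁻¹
    where
    mirror : ∀ {s t : A ⊎ B} → Across s t → Across (Sum.swap s) (Sum.swap t)
    mirror {inj₁ _} {inj₂ _} _ = tt
    mirror {inj₂ _} {inj₁ _} _ = tt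
    mirror⁻¹ : ∀ {s t : A ⊎ B} → Across (Sum.swap s) (Sum.swap t) → Across s t
    mirror⁻¹ {inj₁ _} {inj₂ _} _ = tt
    mirror⁻¹ {inj₂ _} {inj₁ _} _ = tt

module _ {A A′ B : Set} (ι : A ↔ A′) where
  open Inverse ι using (to)

  relabelRows : Decomposable (Rook A B) → Decomposable (Rook A′ B)
  relabelRows = relabel (ι ×-↔ ↔-refl) (adjacent (rowEmbedding to (↔-injective ι))) reflects
    where
    reflects : ∀ {x y : A × B} → Adj (Rook A′ B) (map₁ to x) (map₁ to y) → Adj (Rook A B) x y
    reflects (inj₁ (same-row , b≢b′))   = inj₁ (↔-injective ι same-row , b≢b′)
    reflects (inj₂ (same-column , a≢a′)) = inj₂ (same-column , λ a≡a′ → a≢a′ (cong to a≡a′))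

  relabelBipartite : Decomposable (Bipartite A B) → Decomposable (Bipartite A′ B)
  relabelBipartite = relabel (ι ⊎-↔ ↔-refl) (adjacent (partEmbedding to (↔-injective ι))) reflects
    where
    reflects : ∀ {s t : A ⊎ B} → Across (Sum.map₁ to s) (Sum.map₁ to t) → Across s t
    reflects {inj₁ _} {inj₂ _} _ = tt
    reflects {inj₂ _} {inj₁ _} _ = tt

-- The edges of K_{A⊎B} □ K_n are the edges of the two blocks of rows
-- K_A □ K_n and K_B □ K_n, together with, for every column y, the edges of
-- the complete bipartite graph K_{A,B} joining the two blocks inside y.
module RowJoin {A B : Set} (n : ℕ) where

  top : Embedding (Rook A (Fin n)) (Rook (A ⊎ B) (Fin n))
  top = rowEmbedding inj₁ inj₁-injective

  bottom : Embedding (Rook B (Fin n)) (Rook (A ⊎ B) (Fin n))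
  bottom = rowEmbedding inj₂ inj₂-injective

  column : Fin n → Embedding (Bipartite A B) (Rook (A ⊎ B) (Fin n))
  column y = record
    { map       = _, y
    ; injective = cong proj₁
    ; adjacent  = λ st → inj₂ (refl , Across⇒≢ st)
    }

  Top Bottom Columns : EdgeSet (Rook (A ⊎ B) (Fin n))
  Top     = Image top (Adj (Rook A (Fin n)))
  Bottom  = Image bottom (Adj (Rook B (Fin n)))
  Columns = λ u v → Σ (Fin n) λ y → Image (column y) Across u v

  -- Top edges join two vertices in A, bottom edges two vertices in B, and
  -- column edges a vertex in A to one in B.
  top∩bottom : ∀ {u v} → Top u v → Bottom u v → ⊥
  top∩bottom (_ , _ , _ , refl , _) (_ , _ , _ , () , _)

  top∩columns : ∀ {u v} → Top u v → Columns u v → ⊥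
  top∩columns (_ , _ , _ , refl , refl) (_ , inj₁ _ , inj₂ _ , _ , _ , ())
  top∩columns (_ , _ , _ , refl , refl) (_ , inj₂ _ , inj₁ _ , _ , () , _)

  bottom∩columns : ∀ {u v} → Bottom u v → Columns u v → ⊥
  bottom∩columns (_ , _ , _ , refl , refl) (_ , inj₁ _ , inj₂ _ , _ , () , _)
  bottom∩columns (_ , _ , _ , refl , refl) (_ , inj₂ _ , inj₁ _ , _ , _ , ())

  top∩rest : ∀ {u v} → Top u v → Bottom u v ⊎ Columns u v → ⊥
  top∩rest t (inj₁ b) = top∩bottom t b
  top∩rest t (inj₂ c) = top∩columns t c

  columns-separated : ∀ {y y′ u v} → Image (column y) Across u v → Image (column y′) Across u v → y ≡ y′
  columns-separated (_ , _ , _ , refl , _) (_ , _ , _ , refl , _) = refl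

  classify : ∀ {u v} → Adj (Rook (A ⊎ B) (Fin n)) u v → Top u v ⊎ (Bottom u v ⊎ Columns u v)
  classify {inj₁ a , y} {_ , y′} (inj₁ (refl , y≢y′)) = inj₁ ((a , y) , (a , y′) , inj₁ (refl , y≢y′) , refl , refl)
  classify {inj₂ b , y} {_ , y′} (inj₁ (refl , y≢y′)) = inj₂ (inj₁ ((b , y) , (b , y′) , inj₁ (refl , y≢y′) , refl , refl))
  classify {inj₁ a , y} {inj₁ a′ , _} (inj₂ (refl , s≢s′)) =
    inj₁ ((a , y) , (a′ , y) , inj₂ (refl , λ a≡a′ → s≢s′ (cong inj₁ a≡a′)) , refl , refl)
  classify {inj₂ b , y} {inj₂ b′ , _} (inj₂ (refl , s≢s′)) =
    inj₂ (inj₁ ((b , y) , (b′ , y) , inj₂ (refl , λ b≡b′ → s≢s′ (cong inj₂ b≡b′)) , refl , refl))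
  classify {inj₁ a , y} {inj₂ b , _} (inj₂ (refl , _)) = inj₂ (inj₂ (y , inj₁ a , inj₂ b , tt , refl , refl))
  classify {inj₂ b , y} {inj₁ a , _} (inj₂ (refl , _)) = inj₂ (inj₂ (y , inj₂ b , inj₁ a , tt , refl , refl))

  pieces-adjacent : ∀ {u v} → Top u v ⊎ (Bottom u v ⊎ Columns u v) → Adj (Rook (A ⊎ B) (Fin n)) u v
  pieces-adjacent (inj₁ t)               = image-adjacent top t
  pieces-adjacent (inj₂ (inj₁ b))        = image-adjacent bottom b
  pieces-adjacent (inj₂ (inj₂ (y , c)))  = image-adjacent (column y) c

  rowJoin : Decomposable (Rook A (Fin n)) → Decomposable (Rook B (Fin n)) → Decomposable (Bipartite A B) →
            Decomposable (Rook (A ⊎ B) (Fin n))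
  rowJoin (_ , D₁) (_ , D₂) (_ , D₃) =
    map₂ (restate classify pieces-adjacent)
      (unionᶠ top∩rest (_ , transport top D₁)
        (unionᶠ bottom∩columns (_ , transport bottom D₂)
          (familyᶠ n columns-separated (λ y → transport (column y) D₃))))

open RowJoin using (rowJoin)

module PartJoin {A B C : Set} where

  left : Embedding (Bipartite A C) (Bipartite (A ⊎ B) C)
  left = partEmbedding inj₁ inj₁-injective

  right : Embedding (Bipartite B C) (Bipartite (A ⊎ B) C)
  right = partEmbedding inj₂ inj₂-injective

  Left Right : EdgeSet (Bipartite (A ⊎ B) C)
  Left  = Image left Across
  Right = Image right Across

  left∩right : ∀ {u v} → Left u v → Right u v → ⊥
  left∩right (inj₁ _ , inj₂ _ , _ , refl , _) (inj₁ _ , inj₂ _ , _ , () , _)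
  left∩right (inj₁ _ , inj₂ _ , _ , refl , _) (inj₂ _ , inj₁ _ , _ , () , _)
  left∩right (inj₂ _ , inj₁ _ , _ , refl , refl) (inj₁ _ , inj₂ _ , _ , () , _)
  left∩right (inj₂ _ , inj₁ _ , _ , refl , refl) (inj₂ _ , inj₁ _ , _ , _ , ())

  classify : ∀ {u v} → Across u v → Left u v ⊎ Right u v
  classify {inj₁ (inj₁ a)} {inj₂ c} _ = inj₁ (inj₁ a , inj₂ c , tt , refl , refl)
  classify {inj₁ (inj₂ b)} {inj₂ c} _ = inj₂ (inj₁ b , inj₂ c , tt , refl , refl)
  classify {inj₂ c} {inj₁ (inj₁ a)} _ = inj₁ (inj₂ c , inj₁ a , tt , refl , refl)
  classify {inj₂ c} {inj₁ (inj₂ b)} _ = inj₂ (inj₂ c , inj₁ b , tt , refl , refl)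

  pieces-adjacent : ∀ {u v} → Left u v ⊎ Right u v → Across u v
  pieces-adjacent (inj₁ l) = image-adjacent left l
  pieces-adjacent (inj₂ r) = image-adjacent right r

  partJoin : Decomposable (Bipartite A C) → Decomposable (Bipartite B C) → Decomposable (Bipartite (A ⊎ B) C)
  partJoin (_ , D₁) (_ , D₂) =
    map₂ (restate classify pieces-adjacent) (unionᶠ left∩right (_ , transport left D₁) (_ , transport right D₂))

open PartJoin using (partJoin)

rowJoinᶠ : {a b n : ℕ} → Decomposable (K a □ K n) → Decomposable (K b □ K n) →
           Decomposable (Bipartite (Fin a) (Fin b)) → Decomposable (K (a + b) □ K n)
rowJoinᶠ {n = n} D₁ D₂ D₃ = relabelRows (↔-sym +↔⊎) (rowJoin n D₁ D₂ D₃)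

columnJoinᶠ : {a c d : ℕ} → Decomposable (K a □ K c) → Decomposable (K a □ K d) →
              Decomposable (Bipartite (Fin c) (Fin d)) → Decomposable (K a □ K (c + d))
columnJoinᶠ D₁ D₂ D₃ = swapRook (rowJoinᶠ (swapRook D₁) (swapRook D₂) D₃)

partJoinᶠ : {a b : ℕ} {C : Set} → Decomposable (Bipartite (Fin a) C) → Decomposable (Bipartite (Fin b) C) →
            Decomposable (Bipartite (Fin (a + b)) C)
partJoinᶠ D₁ D₂ = relabelBipartite (↔-sym +↔⊎) (partJoin D₁ D₂)

-- A decomposition of a small graph G given explicitly: copy i has vertices
-- vertex i x₁, …, vertex i x₈, and owner u v names the (copy, edge) claimed to
-- cover the edge {u , v} (its value on non-adjacent pairs is irrelevant).  The
-- four conditions below are decidable, and together they say that the copies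
-- are copies of L_8 in G whose edges partition E(G).
module Certificate (G : Graph) (_≟_ : DecidableEquality (V G)) (adjacent? : ∀ u v → Dec (Adj G u v))
                   (∀? : ∀ {P : V G → Set} → (∀ v → Dec (P v)) → Dec (∀ v → P v))
                   {k : ℕ} (vertex : Fin k → Fin 8 → V G) (owner : V G → V G → Fin k × Fin 8) where

  Copies-injective Copies-edges Owner-covers Owner-consistent : Set
  Copies-injective = ∀ i x y → vertex i x ≡ vertex i y → x ≡ y
  Copies-edges     = ∀ i e → Adj G (vertex i (src e)) (vertex i (tgt e))
  Owner-covers     = ∀ u v → Adj G u v → let (i , e) = owner u v in
                     (vertex i (src e) ≡ u × vertex i (tgt e) ≡ v) ⊎ (vertex i (src e) ≡ v × vertex i (tgt e) ≡ u)
  Owner-consistent = ∀ i e → owner (vertex i (src e)) (vertex i (tgt e)) ≡ (i , e) ×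
                             owner (vertex i (tgt e)) (vertex i (src e)) ≡ (i , e)

  injective? : Dec Copies-injective
  injective? = all? λ i → all? λ x → all? λ y → (vertex i x ≟ vertex i y) →-dec (x ≟ᶠ y)

  edges? : Dec Copies-edges
  edges? = all? λ i → all? λ e → adjacent? _ _

  covers? : Dec Owner-covers
  covers? = ∀? λ u → ∀? λ v → adjacent? u v →-dec
    let (i , e) = owner u v in
    ((vertex i (src e) ≟ u) ×-dec (vertex i (tgt e) ≟ v)) ⊎-dec ((vertex i (src e) ≟ v) ×-dec (vertex i (tgt e) ≟ u))

  consistent? : Dec Owner-consistent
  consistent? = all? λ i → all? λ e →
    (×-≡-dec _≟ᶠ_ _≟ᶠ_ (owner (vertex i (src e)) (vertex i (tgt e))) (i , e)) ×-dec
    (×-≡-dec _≟ᶠ_ _≟ᶠ_ (owner (vertex i (tgt e)) (vertex i (src e))) (i , e))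

  module _ (injective : Copies-injective) (edges : Copies-edges)
           (covers : Owner-covers) (consistent : Owner-consistent) where

    copy′ : Fin k → L8Copy G
    copy′ i = record { f = vertex i ; inj = injective i _ _ ; edges = edges i }

    owned : ∀ {i e u v} → Cov (copy′ i) e u v → owner u v ≡ (i , e)
    owned {i} {e} (forward refl refl)  = proj₁ (consistent i e)
    owned {i} {e} (backward refl refl) = proj₂ (consistent i e)

    decomposition : Decomposable G
    decomposition = k , record
      { copy     = copy′
      ; cover    = λ {u} {v} uv → owner u v , toCov (covers u v uv)
      ; sound    = λ { {i} {e} (forward refl refl)  → edges i e
                     ; {i} {e} (backward refl refl) → Graph.sym G (edges i e) }
      ; disjoint = λ c c′ → trans (≡-sym (owned c)) (owned c′)
      }
      where
      toCov : ∀ {u v} → let (i , e) = owner u v in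
              (vertex i (src e) ≡ u × vertex i (tgt e) ≡ v) ⊎ (vertex i (src e) ≡ v × vertex i (tgt e) ≡ u) →
              Cov (copy′ (proj₁ (owner u v))) (proj₂ (owner u v)) u v
      toCov (inj₁ (p , q)) = forward p q
      toCov (inj₂ (p , q)) = backward p q

  verified : {_ : True injective?} {_ : True edges?} {_ : True covers?} {_ : True consistent?} → Decomposable G
  verified {inj} {edg} {cov} {con} = decomposition (toWitness inj) (toWitness edg) (toWitness cov) (toWitness con)

module _ (a b : ℕ) where

  ∀?-× : ∀ {P : Fin a × Fin b → Set} → (∀ v → Dec (P v)) → Dec (∀ v → P v)
  ∀?-× P? = map′ (λ h v → h (proj₁ v) (proj₂ v)) (λ h x y → h (x , y)) (all? λ x → all? λ y → P? (x , y))

  ∀?-⊎ : ∀ {P : Fin a ⊎ Fin b → Set} → (∀ v → Dec (P v)) → Dec (∀ v → P v)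
  ∀?-⊎ {P} P? = map′ both (λ h → (λ x → h (inj₁ x)) , (λ y → h (inj₂ y)))
                     ((all? λ x → P? (inj₁ x)) ×-dec (all? λ y → P? (inj₂ y)))
    where
    both : (∀ x → P (inj₁ x)) × (∀ y → P (inj₂ y)) → ∀ v → P v
    both (h , _) (inj₁ x) = h x
    both (_ , h) (inj₂ y) = h y

  rook-adjacent? : ∀ u v → Dec (Adj (K a □ K b) u v)
  rook-adjacent? (x , y) (x′ , y′) = ((x ≟ᶠ x′) ×-dec ¬? (y ≟ᶠ y′)) ⊎-dec ((y ≟ᶠ y′) ×-dec ¬? (x ≟ᶠ x′))

  across? : ∀ u v → Dec (Across {Fin a} {Fin b} u v)
  across? (inj₁ _) (inj₁ _) = no λ ()
  across? (inj₁ _) (inj₂ _) = yes tt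
  across? (inj₂ _) (inj₁ _) = yes tt
  across? (inj₂ _) (inj₂ _) = no λ ()

-- Certificates for K_a □ K_b, the owner table indexed by the codes combine x y
-- of the vertices (x , y), and for K_{a,b}, indexed by the codes join a b s.
module RookCertificate (a b : ℕ) {k : ℕ} (copies : Vec (Vec (Fin a × Fin b) 8) k)
                       (owners : Vec (Vec (Fin k × Fin 8) (a * b)) (a * b)) =
  Certificate (K a □ K b) (×-≡-dec _≟ᶠ_ _≟ᶠ_) (rook-adjacent? a b) (∀?-× a b)
              (λ i x → lookup (lookup copies i) x)
              (λ u v → lookup (lookup owners (uncurry combine u)) (uncurry combine v))

module BipartiteCertificate (a b : ℕ) {k : ℕ} (copies : Vec (Vec (Fin a ⊎ Fin b) 8) k)
                            (owners : Vec (Vec (Fin k × Fin 8) (a + b)) (a + b)) =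
  Certificate (Bipartite (Fin a) (Fin b)) (⊎-≡-dec _≟ᶠ_ _≟ᶠ_) (across? a b) (∀?-⊎ a b)
              (λ i x → lookup (lookup copies i) x)
              (λ u v → lookup (lookup owners (join a b u)) (join a b v))

K₄□K₂ : Decomposable (K 4 □ K 2)
K₄□K₂ = RookCertificate.verified 4 2 copies owners
  where
  copies : Vec (Vec (Fin 4 × Fin 2) 8) 2
  copies =
    ((# 3 , # 0) ∷ (# 3 , # 1) ∷ (# 0 , # 1) ∷ (# 0 , # 0) ∷ (# 1 , # 0) ∷ (# 1 , # 1) ∷ (# 2 , # 1) ∷ (# 2 , # 0) ∷ []) ∷
    ((# 2 , # 1) ∷ (# 1 , # 1) ∷ (# 1 , # 0) ∷ (# 2 , # 0) ∷ (# 3 , # 1) ∷ (# 0 , # 1) ∷ (# 0 , # 0) ∷ (# 3 , # 0) ∷ []) ∷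
    []
  owners : Vec (Vec (Fin 2 × Fin 8) 8) 8
  owners =
    ((# 0 , # 0) ∷ (# 0 , # 2) ∷ (# 1 , # 6) ∷ (# 0 , # 0) ∷ (# 0 , # 7) ∷ (# 0 , # 0) ∷ (# 0 , # 3) ∷ (# 0 , # 0) ∷ []) ∷
    ((# 0 , # 2) ∷ (# 0 , # 0) ∷ (# 0 , # 0) ∷ (# 1 , # 5) ∷ (# 0 , # 0) ∷ (# 0 , # 6) ∷ (# 0 , # 0) ∷ (# 0 , # 1) ∷ []) ∷
    ((# 1 , # 6) ∷ (# 0 , # 0) ∷ (# 0 , # 0) ∷ (# 1 , # 1) ∷ (# 1 , # 2) ∷ (# 0 , # 0) ∷ (# 0 , # 4) ∷ (# 0 , # 0) ∷ []) ∷
    ((# 0 , # 0) ∷ (# 1 , # 5) ∷ (# 1 , # 1) ∷ (# 0 , # 0) ∷ (# 0 , # 0) ∷ (# 1 , # 0) ∷ (# 0 , # 0) ∷ (# 0 , # 5) ∷ []) ∷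
    ((# 0 , # 7) ∷ (# 0 , # 0) ∷ (# 1 , # 2) ∷ (# 0 , # 0) ∷ (# 0 , # 0) ∷ (# 1 , # 3) ∷ (# 1 , # 7) ∷ (# 0 , # 0) ∷ []) ∷
    ((# 0 , # 0) ∷ (# 0 , # 6) ∷ (# 0 , # 0) ∷ (# 1 , # 0) ∷ (# 1 , # 3) ∷ (# 0 , # 0) ∷ (# 0 , # 0) ∷ (# 1 , # 4) ∷ []) ∷
    ((# 0 , # 3) ∷ (# 0 , # 0) ∷ (# 0 , # 4) ∷ (# 0 , # 0) ∷ (# 1 , # 7) ∷ (# 0 , # 0) ∷ (# 0 , # 0) ∷ (# 0 , # 0) ∷ []) ∷
    ((# 0 , # 0) ∷ (# 0 , # 1) ∷ (# 0 , # 0) ∷ (# 0 , # 5) ∷ (# 0 , # 0) ∷ (# 1 , # 4) ∷ (# 0 , # 0) ∷ (# 0 , # 0) ∷ []) ∷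
    []

K₄□K₄ : Decomposable (K 4 □ K 4)
K₄□K₄ = RookCertificate.verified 4 4 copies owners
  where
  copies : Vec (Vec (Fin 4 × Fin 4) 8) 6
  copies =
    ((# 1 , # 3) ∷ (# 1 , # 2) ∷ (# 0 , # 2) ∷ (# 0 , # 3) ∷ (# 2 , # 3) ∷ (# 2 , # 2) ∷ (# 3 , # 2) ∷ (# 0 , # 1) ∷ []) ∷
    ((# 3 , # 3) ∷ (# 2 , # 3) ∷ (# 2 , # 1) ∷ (# 3 , # 1) ∷ (# 1 , # 3) ∷ (# 2 , # 2) ∷ (# 0 , # 1) ∷ (# 3 , # 0) ∷ []) ∷
    ((# 0 , # 3) ∷ (# 0 , # 0) ∷ (# 3 , # 0) ∷ (# 3 , # 3) ∷ (# 2 , # 3) ∷ (# 0 , # 1) ∷ (# 1 , # 0) ∷ (# 3 , # 2) ∷ []) ∷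
    ((# 2 , # 0) ∷ (# 2 , # 1) ∷ (# 1 , # 1) ∷ (# 1 , # 0) ∷ (# 2 , # 3) ∷ (# 2 , # 2) ∷ (# 0 , # 1) ∷ (# 1 , # 3) ∷ []) ∷
    ((# 1 , # 1) ∷ (# 3 , # 1) ∷ (# 3 , # 2) ∷ (# 1 , # 2) ∷ (# 1 , # 3) ∷ (# 0 , # 1) ∷ (# 3 , # 0) ∷ (# 1 , # 0) ∷ []) ∷
    ((# 2 , # 2) ∷ (# 2 , # 0) ∷ (# 0 , # 0) ∷ (# 0 , # 2) ∷ (# 3 , # 2) ∷ (# 3 , # 0) ∷ (# 1 , # 0) ∷ (# 0 , # 1) ∷ []) ∷
    []
  owners : Vec (Vec (Fin 6 × Fin 8) 16) 16
  owners =
    ((# 0 , # 0) ∷ (# 2 , # 5) ∷ (# 5 , # 2) ∷ (# 2 , # 0) ∷ (# 5 , # 6) ∷ (# 0 , # 0) ∷ (# 0 , # 0) ∷ (# 0 , # 0) ∷ (# 5 , # 1) ∷ (# 0 , # 0) ∷ (# 0 , # 0) ∷ (# 0 , # 0) ∷ (# 2 , # 1) ∷ (# 0 , # 0) ∷ (# 0 , # 0) ∷ (# 0 , # 0) ∷ []) ∷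
    ((# 2 , # 5) ∷ (# 0 , # 0) ∷ (# 5 , # 7) ∷ (# 0 , # 7) ∷ (# 0 , # 0) ∷ (# 3 , # 6) ∷ (# 0 , # 0) ∷ (# 0 , # 0) ∷ (# 0 , # 0) ∷ (# 1 , # 6) ∷ (# 0 , # 0) ∷ (# 0 , # 0) ∷ (# 0 , # 0) ∷ (# 4 , # 5) ∷ (# 0 , # 0) ∷ (# 0 , # 0) ∷ []) ∷
    ((# 5 , # 2) ∷ (# 5 , # 7) ∷ (# 0 , # 0) ∷ (# 0 , # 2) ∷ (# 0 , # 0) ∷ (# 0 , # 0) ∷ (# 0 , # 1) ∷ (# 0 , # 0) ∷ (# 0 , # 0) ∷ (# 0 , # 0) ∷ (# 5 , # 3) ∷ (# 0 , # 0) ∷ (# 0 , # 0) ∷ (# 0 , # 0) ∷ (# 0 , # 6) ∷ (# 0 , # 0) ∷ []) ∷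
    ((# 2 , # 0) ∷ (# 0 , # 7) ∷ (# 0 , # 2) ∷ (# 0 , # 0) ∷ (# 0 , # 0) ∷ (# 0 , # 0) ∷ (# 0 , # 0) ∷ (# 0 , # 3) ∷ (# 0 , # 0) ∷ (# 0 , # 0) ∷ (# 0 , # 0) ∷ (# 2 , # 4) ∷ (# 0 , # 0) ∷ (# 0 , # 0) ∷ (# 0 , # 0) ∷ (# 2 , # 3) ∷ []) ∷
    ((# 5 , # 6) ∷ (# 0 , # 0) ∷ (# 0 , # 0) ∷ (# 0 , # 0) ∷ (# 0 , # 0) ∷ (# 3 , # 2) ∷ (# 4 , # 7) ∷ (# 3 , # 7) ∷ (# 3 , # 3) ∷ (# 0 , # 0) ∷ (# 0 , # 0) ∷ (# 0 , # 0) ∷ (# 2 , # 6) ∷ (# 0 , # 0) ∷ (# 0 , # 0) ∷ (# 0 , # 0) ∷ []) ∷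
    ((# 0 , # 0) ∷ (# 3 , # 6) ∷ (# 0 , # 0) ∷ (# 0 , # 0) ∷ (# 3 , # 2) ∷ (# 0 , # 0) ∷ (# 4 , # 3) ∷ (# 4 , # 4) ∷ (# 0 , # 0) ∷ (# 3 , # 1) ∷ (# 0 , # 0) ∷ (# 0 , # 0) ∷ (# 0 , # 0) ∷ (# 4 , # 0) ∷ (# 0 , # 0) ∷ (# 0 , # 0) ∷ []) ∷
    ((# 0 , # 0) ∷ (# 0 , # 0) ∷ (# 0 , # 1) ∷ (# 0 , # 0) ∷ (# 4 , # 7) ∷ (# 4 , # 3) ∷ (# 0 , # 0) ∷ (# 0 , # 0) ∷ (# 0 , # 0) ∷ (# 0 , # 0) ∷ (# 0 , # 5) ∷ (# 0 , # 0) ∷ (# 0 , # 0) ∷ (# 0 , # 0) ∷ (# 4 , # 2) ∷ (# 0 , # 0) ∷ []) ∷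
    ((# 0 , # 0) ∷ (# 0 , # 0) ∷ (# 0 , # 0) ∷ (# 0 , # 3) ∷ (# 3 , # 7) ∷ (# 4 , # 4) ∷ (# 0 , # 0) ∷ (# 0 , # 0) ∷ (# 0 , # 0) ∷ (# 0 , # 0) ∷ (# 0 , # 0) ∷ (# 0 , # 4) ∷ (# 0 , # 0) ∷ (# 0 , # 0) ∷ (# 0 , # 0) ∷ (# 1 , # 4) ∷ []) ∷
    ((# 5 , # 1) ∷ (# 0 , # 0) ∷ (# 0 , # 0) ∷ (# 0 , # 0) ∷ (# 3 , # 3) ∷ (# 0 , # 0) ∷ (# 0 , # 0) ∷ (# 0 , # 0) ∷ (# 0 , # 0) ∷ (# 3 , # 0) ∷ (# 5 , # 0) ∷ (# 3 , # 4) ∷ (# 5 , # 5) ∷ (# 0 , # 0) ∷ (# 0 , # 0) ∷ (# 0 , # 0) ∷ []) ∷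
    ((# 0 , # 0) ∷ (# 1 , # 6) ∷ (# 0 , # 0) ∷ (# 0 , # 0) ∷ (# 0 , # 0) ∷ (# 3 , # 1) ∷ (# 0 , # 0) ∷ (# 0 , # 0) ∷ (# 3 , # 0) ∷ (# 0 , # 0) ∷ (# 3 , # 5) ∷ (# 1 , # 1) ∷ (# 0 , # 0) ∷ (# 1 , # 2) ∷ (# 0 , # 0) ∷ (# 0 , # 0) ∷ []) ∷
    ((# 0 , # 0) ∷ (# 0 , # 0) ∷ (# 5 , # 3) ∷ (# 0 , # 0) ∷ (# 0 , # 0) ∷ (# 0 , # 0) ∷ (# 0 , # 5) ∷ (# 0 , # 0) ∷ (# 5 , # 0) ∷ (# 3 , # 5) ∷ (# 0 , # 0) ∷ (# 1 , # 5) ∷ (# 0 , # 0) ∷ (# 0 , # 0) ∷ (# 5 , # 4) ∷ (# 0 , # 0) ∷ []) ∷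
    ((# 0 , # 0) ∷ (# 0 , # 0) ∷ (# 0 , # 0) ∷ (# 2 , # 4) ∷ (# 0 , # 0) ∷ (# 0 , # 0) ∷ (# 0 , # 0) ∷ (# 0 , # 4) ∷ (# 3 , # 4) ∷ (# 1 , # 1) ∷ (# 1 , # 5) ∷ (# 0 , # 0) ∷ (# 0 , # 0) ∷ (# 0 , # 0) ∷ (# 0 , # 0) ∷ (# 1 , # 0) ∷ []) ∷
    ((# 2 , # 1) ∷ (# 0 , # 0) ∷ (# 0 , # 0) ∷ (# 0 , # 0) ∷ (# 2 , # 6) ∷ (# 0 , # 0) ∷ (# 0 , # 0) ∷ (# 0 , # 0) ∷ (# 5 , # 5) ∷ (# 0 , # 0) ∷ (# 0 , # 0) ∷ (# 0 , # 0) ∷ (# 0 , # 0) ∷ (# 1 , # 7) ∷ (# 4 , # 6) ∷ (# 2 , # 2) ∷ []) ∷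
    ((# 0 , # 0) ∷ (# 4 , # 5) ∷ (# 0 , # 0) ∷ (# 0 , # 0) ∷ (# 0 , # 0) ∷ (# 4 , # 0) ∷ (# 0 , # 0) ∷ (# 0 , # 0) ∷ (# 0 , # 0) ∷ (# 1 , # 2) ∷ (# 0 , # 0) ∷ (# 0 , # 0) ∷ (# 1 , # 7) ∷ (# 0 , # 0) ∷ (# 4 , # 1) ∷ (# 1 , # 3) ∷ []) ∷
    ((# 0 , # 0) ∷ (# 0 , # 0) ∷ (# 0 , # 6) ∷ (# 0 , # 0) ∷ (# 0 , # 0) ∷ (# 0 , # 0) ∷ (# 4 , # 2) ∷ (# 0 , # 0) ∷ (# 0 , # 0) ∷ (# 0 , # 0) ∷ (# 5 , # 4) ∷ (# 0 , # 0) ∷ (# 4 , # 6) ∷ (# 4 , # 1) ∷ (# 0 , # 0) ∷ (# 2 , # 7) ∷ []) ∷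
    ((# 0 , # 0) ∷ (# 0 , # 0) ∷ (# 0 , # 0) ∷ (# 2 , # 3) ∷ (# 0 , # 0) ∷ (# 0 , # 0) ∷ (# 0 , # 0) ∷ (# 1 , # 4) ∷ (# 0 , # 0) ∷ (# 0 , # 0) ∷ (# 0 , # 0) ∷ (# 1 , # 0) ∷ (# 2 , # 2) ∷ (# 1 , # 3) ∷ (# 2 , # 7) ∷ (# 0 , # 0) ∷ []) ∷
    []

K₄□K₆ : Decomposable (K 4 □ K 6)
K₄□K₆ = RookCertificate.verified 4 6 copies owners
  where
  copies : Vec (Vec (Fin 4 × Fin 6) 8) 12
  copies =
    ((# 0 , # 0) ∷ (# 2 , # 0) ∷ (# 2 , # 3) ∷ (# 0 , # 3) ∷ (# 0 , # 4) ∷ (# 2 , # 4) ∷ (# 2 , # 1) ∷ (# 0 , # 1) ∷ []) ∷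
    ((# 1 , # 2) ∷ (# 3 , # 2) ∷ (# 3 , # 5) ∷ (# 1 , # 5) ∷ (# 1 , # 0) ∷ (# 3 , # 0) ∷ (# 3 , # 3) ∷ (# 1 , # 3) ∷ []) ∷
    ((# 2 , # 4) ∷ (# 0 , # 4) ∷ (# 0 , # 1) ∷ (# 2 , # 1) ∷ (# 2 , # 2) ∷ (# 0 , # 2) ∷ (# 0 , # 5) ∷ (# 2 , # 5) ∷ []) ∷
    ((# 3 , # 0) ∷ (# 1 , # 0) ∷ (# 1 , # 3) ∷ (# 3 , # 3) ∷ (# 3 , # 4) ∷ (# 1 , # 4) ∷ (# 1 , # 1) ∷ (# 3 , # 1) ∷ []) ∷
    ((# 0 , # 2) ∷ (# 2 , # 2) ∷ (# 2 , # 5) ∷ (# 0 , # 5) ∷ (# 0 , # 0) ∷ (# 2 , # 0) ∷ (# 2 , # 3) ∷ (# 0 , # 3) ∷ []) ∷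
    ((# 1 , # 4) ∷ (# 3 , # 4) ∷ (# 3 , # 1) ∷ (# 1 , # 1) ∷ (# 1 , # 2) ∷ (# 3 , # 2) ∷ (# 3 , # 5) ∷ (# 1 , # 5) ∷ []) ∷
    ((# 0 , # 0) ∷ (# 1 , # 0) ∷ (# 2 , # 0) ∷ (# 3 , # 0) ∷ (# 0 , # 1) ∷ (# 1 , # 1) ∷ (# 2 , # 1) ∷ (# 3 , # 1) ∷ []) ∷
    ((# 1 , # 2) ∷ (# 2 , # 2) ∷ (# 3 , # 2) ∷ (# 0 , # 2) ∷ (# 1 , # 3) ∷ (# 2 , # 3) ∷ (# 3 , # 3) ∷ (# 0 , # 3) ∷ []) ∷
    ((# 2 , # 4) ∷ (# 3 , # 4) ∷ (# 0 , # 4) ∷ (# 1 , # 4) ∷ (# 2 , # 5) ∷ (# 3 , # 5) ∷ (# 0 , # 5) ∷ (# 1 , # 5) ∷ []) ∷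
    ((# 2 , # 5) ∷ (# 1 , # 5) ∷ (# 0 , # 5) ∷ (# 3 , # 5) ∷ (# 2 , # 0) ∷ (# 1 , # 0) ∷ (# 0 , # 0) ∷ (# 3 , # 0) ∷ []) ∷
    ((# 3 , # 1) ∷ (# 2 , # 1) ∷ (# 1 , # 1) ∷ (# 0 , # 1) ∷ (# 3 , # 2) ∷ (# 2 , # 2) ∷ (# 1 , # 2) ∷ (# 0 , # 2) ∷ []) ∷
    ((# 0 , # 3) ∷ (# 3 , # 3) ∷ (# 2 , # 3) ∷ (# 1 , # 3) ∷ (# 0 , # 4) ∷ (# 3 , # 4) ∷ (# 2 , # 4) ∷ (# 1 , # 4) ∷ []) ∷
    []
  owners : Vec (Vec (Fin 12 × Fin 8) 24) 24
  owners =
    ((# 0 , # 0) ∷ (# 6 , # 4) ∷ (# 4 , # 4) ∷ (# 0 , # 3) ∷ (# 0 , # 4) ∷ (# 9 , # 6) ∷ (# 6 , # 0) ∷ (# 0 , # 0) ∷ (# 0 , # 0) ∷ (# 0 , # 0) ∷ (# 0 , # 0) ∷ (# 0 , # 0) ∷ (# 0 , # 0) ∷ (# 0 , # 0) ∷ (# 0 , # 0) ∷ (# 0 , # 0) ∷ (# 0 , # 0) ∷ (# 0 , # 0) ∷ (# 6 , # 3) ∷ (# 0 , # 0) ∷ (# 0 , # 0) ∷ (# 0 , # 0) ∷ (# 0 , # 0) ∷ (# 0 , # 0) ∷ []) ∷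
    ((# 6 , # 4) ∷ (# 0 , # 0) ∷ (# 10 , # 7) ∷ (# 0 , # 7) ∷ (# 2 , # 1) ∷ (# 2 , # 6) ∷ (# 0 , # 0) ∷ (# 10 , # 2) ∷ (# 0 , # 0) ∷ (# 0 , # 0) ∷ (# 0 , # 0) ∷ (# 0 , # 0) ∷ (# 0 , # 0) ∷ (# 2 , # 2) ∷ (# 0 , # 0) ∷ (# 0 , # 0) ∷ (# 0 , # 0) ∷ (# 0 , # 0) ∷ (# 0 , # 0) ∷ (# 10 , # 3) ∷ (# 0 , # 0) ∷ (# 0 , # 0) ∷ (# 0 , # 0) ∷ (# 0 , # 0) ∷ []) ∷
    ((# 4 , # 4) ∷ (# 10 , # 7) ∷ (# 0 , # 0) ∷ (# 7 , # 7) ∷ (# 2 , # 5) ∷ (# 4 , # 3) ∷ (# 0 , # 0) ∷ (# 0 , # 0) ∷ (# 7 , # 3) ∷ (# 0 , # 0) ∷ (# 0 , # 0) ∷ (# 0 , # 0) ∷ (# 0 , # 0) ∷ (# 0 , # 0) ∷ (# 4 , # 0) ∷ (# 0 , # 0) ∷ (# 0 , # 0) ∷ (# 0 , # 0) ∷ (# 0 , # 0) ∷ (# 0 , # 0) ∷ (# 7 , # 2) ∷ (# 0 , # 0) ∷ (# 0 , # 0) ∷ (# 0 , # 0) ∷ []) ∷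
    ((# 0 , # 3) ∷ (# 0 , # 7) ∷ (# 7 , # 7) ∷ (# 0 , # 0) ∷ (# 11 , # 4) ∷ (# 4 , # 7) ∷ (# 0 , # 0) ∷ (# 0 , # 0) ∷ (# 0 , # 0) ∷ (# 11 , # 3) ∷ (# 0 , # 0) ∷ (# 0 , # 0) ∷ (# 0 , # 0) ∷ (# 0 , # 0) ∷ (# 0 , # 0) ∷ (# 0 , # 2) ∷ (# 0 , # 0) ∷ (# 0 , # 0) ∷ (# 0 , # 0) ∷ (# 0 , # 0) ∷ (# 0 , # 0) ∷ (# 11 , # 0) ∷ (# 0 , # 0) ∷ (# 0 , # 0) ∷ []) ∷
    ((# 0 , # 4) ∷ (# 2 , # 1) ∷ (# 2 , # 5) ∷ (# 11 , # 4) ∷ (# 0 , # 0) ∷ (# 8 , # 6) ∷ (# 0 , # 0) ∷ (# 0 , # 0) ∷ (# 0 , # 0) ∷ (# 0 , # 0) ∷ (# 8 , # 2) ∷ (# 0 , # 0) ∷ (# 0 , # 0) ∷ (# 0 , # 0) ∷ (# 0 , # 0) ∷ (# 0 , # 0) ∷ (# 2 , # 0) ∷ (# 0 , # 0) ∷ (# 0 , # 0) ∷ (# 0 , # 0) ∷ (# 0 , # 0) ∷ (# 0 , # 0) ∷ (# 8 , # 1) ∷ (# 0 , # 0) ∷ []) ∷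
    ((# 9 , # 6) ∷ (# 2 , # 6) ∷ (# 4 , # 3) ∷ (# 4 , # 7) ∷ (# 8 , # 6) ∷ (# 0 , # 0) ∷ (# 0 , # 0) ∷ (# 0 , # 0) ∷ (# 0 , # 0) ∷ (# 0 , # 0) ∷ (# 0 , # 0) ∷ (# 9 , # 1) ∷ (# 0 , # 0) ∷ (# 0 , # 0) ∷ (# 0 , # 0) ∷ (# 0 , # 0) ∷ (# 0 , # 0) ∷ (# 4 , # 2) ∷ (# 0 , # 0) ∷ (# 0 , # 0) ∷ (# 0 , # 0) ∷ (# 0 , # 0) ∷ (# 0 , # 0) ∷ (# 9 , # 2) ∷ []) ∷
    ((# 6 , # 0) ∷ (# 0 , # 0) ∷ (# 0 , # 0) ∷ (# 0 , # 0) ∷ (# 0 , # 0) ∷ (# 0 , # 0) ∷ (# 0 , # 0) ∷ (# 6 , # 5) ∷ (# 1 , # 4) ∷ (# 3 , # 1) ∷ (# 3 , # 5) ∷ (# 9 , # 5) ∷ (# 6 , # 1) ∷ (# 0 , # 0) ∷ (# 0 , # 0) ∷ (# 0 , # 0) ∷ (# 0 , # 0) ∷ (# 0 , # 0) ∷ (# 3 , # 0) ∷ (# 0 , # 0) ∷ (# 0 , # 0) ∷ (# 0 , # 0) ∷ (# 0 , # 0) ∷ (# 0 , # 0) ∷ []) ∷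
    ((# 0 , # 0) ∷ (# 10 , # 2) ∷ (# 0 , # 0) ∷ (# 0 , # 0) ∷ (# 0 , # 0) ∷ (# 0 , # 0) ∷ (# 6 , # 5) ∷ (# 0 , # 0) ∷ (# 10 , # 6) ∷ (# 3 , # 6) ∷ (# 5 , # 3) ∷ (# 5 , # 7) ∷ (# 0 , # 0) ∷ (# 10 , # 1) ∷ (# 0 , # 0) ∷ (# 0 , # 0) ∷ (# 0 , # 0) ∷ (# 0 , # 0) ∷ (# 0 , # 0) ∷ (# 5 , # 2) ∷ (# 0 , # 0) ∷ (# 0 , # 0) ∷ (# 0 , # 0) ∷ (# 0 , # 0) ∷ []) ∷
    ((# 0 , # 0) ∷ (# 0 , # 0) ∷ (# 7 , # 3) ∷ (# 0 , # 0) ∷ (# 0 , # 0) ∷ (# 0 , # 0) ∷ (# 1 , # 4) ∷ (# 10 , # 6) ∷ (# 0 , # 0) ∷ (# 7 , # 4) ∷ (# 5 , # 4) ∷ (# 1 , # 3) ∷ (# 0 , # 0) ∷ (# 0 , # 0) ∷ (# 7 , # 0) ∷ (# 0 , # 0) ∷ (# 0 , # 0) ∷ (# 0 , # 0) ∷ (# 0 , # 0) ∷ (# 0 , # 0) ∷ (# 1 , # 0) ∷ (# 0 , # 0) ∷ (# 0 , # 0) ∷ (# 0 , # 0) ∷ []) ∷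
    ((# 0 , # 0) ∷ (# 0 , # 0) ∷ (# 0 , # 0) ∷ (# 11 , # 3) ∷ (# 0 , # 0) ∷ (# 0 , # 0) ∷ (# 3 , # 1) ∷ (# 3 , # 6) ∷ (# 7 , # 4) ∷ (# 0 , # 0) ∷ (# 11 , # 7) ∷ (# 1 , # 7) ∷ (# 0 , # 0) ∷ (# 0 , # 0) ∷ (# 0 , # 0) ∷ (# 11 , # 2) ∷ (# 0 , # 0) ∷ (# 0 , # 0) ∷ (# 0 , # 0) ∷ (# 0 , # 0) ∷ (# 0 , # 0) ∷ (# 3 , # 2) ∷ (# 0 , # 0) ∷ (# 0 , # 0) ∷ []) ∷
    ((# 0 , # 0) ∷ (# 0 , # 0) ∷ (# 0 , # 0) ∷ (# 0 , # 0) ∷ (# 8 , # 2) ∷ (# 0 , # 0) ∷ (# 3 , # 5) ∷ (# 5 , # 3) ∷ (# 5 , # 4) ∷ (# 11 , # 7) ∷ (# 0 , # 0) ∷ (# 8 , # 7) ∷ (# 0 , # 0) ∷ (# 0 , # 0) ∷ (# 0 , # 0) ∷ (# 0 , # 0) ∷ (# 8 , # 3) ∷ (# 0 , # 0) ∷ (# 0 , # 0) ∷ (# 0 , # 0) ∷ (# 0 , # 0) ∷ (# 0 , # 0) ∷ (# 5 , # 0) ∷ (# 0 , # 0) ∷ []) ∷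
    ((# 0 , # 0) ∷ (# 0 , # 0) ∷ (# 0 , # 0) ∷ (# 0 , # 0) ∷ (# 0 , # 0) ∷ (# 9 , # 1) ∷ (# 9 , # 5) ∷ (# 5 , # 7) ∷ (# 1 , # 3) ∷ (# 1 , # 7) ∷ (# 8 , # 7) ∷ (# 0 , # 0) ∷ (# 0 , # 0) ∷ (# 0 , # 0) ∷ (# 0 , # 0) ∷ (# 0 , # 0) ∷ (# 0 , # 0) ∷ (# 9 , # 0) ∷ (# 0 , # 0) ∷ (# 0 , # 0) ∷ (# 0 , # 0) ∷ (# 0 , # 0) ∷ (# 0 , # 0) ∷ (# 1 , # 2) ∷ []) ∷
    ((# 0 , # 0) ∷ (# 0 , # 0) ∷ (# 0 , # 0) ∷ (# 0 , # 0) ∷ (# 0 , # 0) ∷ (# 0 , # 0) ∷ (# 6 , # 1) ∷ (# 0 , # 0) ∷ (# 0 , # 0) ∷ (# 0 , # 0) ∷ (# 0 , # 0) ∷ (# 0 , # 0) ∷ (# 0 , # 0) ∷ (# 6 , # 6) ∷ (# 4 , # 5) ∷ (# 0 , # 1) ∷ (# 0 , # 5) ∷ (# 9 , # 4) ∷ (# 6 , # 2) ∷ (# 0 , # 0) ∷ (# 0 , # 0) ∷ (# 0 , # 0) ∷ (# 0 , # 0) ∷ (# 0 , # 0) ∷ []) ∷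
    ((# 0 , # 0) ∷ (# 2 , # 2) ∷ (# 0 , # 0) ∷ (# 0 , # 0) ∷ (# 0 , # 0) ∷ (# 0 , # 0) ∷ (# 0 , # 0) ∷ (# 10 , # 1) ∷ (# 0 , # 0) ∷ (# 0 , # 0) ∷ (# 0 , # 0) ∷ (# 0 , # 0) ∷ (# 6 , # 6) ∷ (# 0 , # 0) ∷ (# 10 , # 5) ∷ (# 0 , # 6) ∷ (# 2 , # 3) ∷ (# 2 , # 7) ∷ (# 0 , # 0) ∷ (# 10 , # 0) ∷ (# 0 , # 0) ∷ (# 0 , # 0) ∷ (# 0 , # 0) ∷ (# 0 , # 0) ∷ []) ∷
    ((# 0 , # 0) ∷ (# 0 , # 0) ∷ (# 4 , # 0) ∷ (# 0 , # 0) ∷ (# 0 , # 0) ∷ (# 0 , # 0) ∷ (# 0 , # 0) ∷ (# 0 , # 0) ∷ (# 7 , # 0) ∷ (# 0 , # 0) ∷ (# 0 , # 0) ∷ (# 0 , # 0) ∷ (# 4 , # 5) ∷ (# 10 , # 5) ∷ (# 0 , # 0) ∷ (# 7 , # 5) ∷ (# 2 , # 4) ∷ (# 4 , # 1) ∷ (# 0 , # 0) ∷ (# 0 , # 0) ∷ (# 7 , # 1) ∷ (# 0 , # 0) ∷ (# 0 , # 0) ∷ (# 0 , # 0) ∷ []) ∷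
    ((# 0 , # 0) ∷ (# 0 , # 0) ∷ (# 0 , # 0) ∷ (# 0 , # 2) ∷ (# 0 , # 0) ∷ (# 0 , # 0) ∷ (# 0 , # 0) ∷ (# 0 , # 0) ∷ (# 0 , # 0) ∷ (# 11 , # 2) ∷ (# 0 , # 0) ∷ (# 0 , # 0) ∷ (# 0 , # 1) ∷ (# 0 , # 6) ∷ (# 7 , # 5) ∷ (# 0 , # 0) ∷ (# 11 , # 6) ∷ (# 4 , # 6) ∷ (# 0 , # 0) ∷ (# 0 , # 0) ∷ (# 0 , # 0) ∷ (# 11 , # 1) ∷ (# 0 , # 0) ∷ (# 0 , # 0) ∷ []) ∷
    ((# 0 , # 0) ∷ (# 0 , # 0) ∷ (# 0 , # 0) ∷ (# 0 , # 0) ∷ (# 2 , # 0) ∷ (# 0 , # 0) ∷ (# 0 , # 0) ∷ (# 0 , # 0) ∷ (# 0 , # 0) ∷ (# 0 , # 0) ∷ (# 8 , # 3) ∷ (# 0 , # 0) ∷ (# 0 , # 5) ∷ (# 2 , # 3) ∷ (# 2 , # 4) ∷ (# 11 , # 6) ∷ (# 0 , # 0) ∷ (# 8 , # 4) ∷ (# 0 , # 0) ∷ (# 0 , # 0) ∷ (# 0 , # 0) ∷ (# 0 , # 0) ∷ (# 8 , # 0) ∷ (# 0 , # 0) ∷ []) ∷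
    ((# 0 , # 0) ∷ (# 0 , # 0) ∷ (# 0 , # 0) ∷ (# 0 , # 0) ∷ (# 0 , # 0) ∷ (# 4 , # 2) ∷ (# 0 , # 0) ∷ (# 0 , # 0) ∷ (# 0 , # 0) ∷ (# 0 , # 0) ∷ (# 0 , # 0) ∷ (# 9 , # 0) ∷ (# 9 , # 4) ∷ (# 2 , # 7) ∷ (# 4 , # 1) ∷ (# 4 , # 6) ∷ (# 8 , # 4) ∷ (# 0 , # 0) ∷ (# 0 , # 0) ∷ (# 0 , # 0) ∷ (# 0 , # 0) ∷ (# 0 , # 0) ∷ (# 0 , # 0) ∷ (# 9 , # 3) ∷ []) ∷
    ((# 6 , # 3) ∷ (# 0 , # 0) ∷ (# 0 , # 0) ∷ (# 0 , # 0) ∷ (# 0 , # 0) ∷ (# 0 , # 0) ∷ (# 3 , # 0) ∷ (# 0 , # 0) ∷ (# 0 , # 0) ∷ (# 0 , # 0) ∷ (# 0 , # 0) ∷ (# 0 , # 0) ∷ (# 6 , # 2) ∷ (# 0 , # 0) ∷ (# 0 , # 0) ∷ (# 0 , # 0) ∷ (# 0 , # 0) ∷ (# 0 , # 0) ∷ (# 0 , # 0) ∷ (# 6 , # 7) ∷ (# 1 , # 5) ∷ (# 3 , # 3) ∷ (# 3 , # 4) ∷ (# 9 , # 7) ∷ []) ∷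
    ((# 0 , # 0) ∷ (# 10 , # 3) ∷ (# 0 , # 0) ∷ (# 0 , # 0) ∷ (# 0 , # 0) ∷ (# 0 , # 0) ∷ (# 0 , # 0) ∷ (# 5 , # 2) ∷ (# 0 , # 0) ∷ (# 0 , # 0) ∷ (# 0 , # 0) ∷ (# 0 , # 0) ∷ (# 0 , # 0) ∷ (# 10 , # 0) ∷ (# 0 , # 0) ∷ (# 0 , # 0) ∷ (# 0 , # 0) ∷ (# 0 , # 0) ∷ (# 6 , # 7) ∷ (# 0 , # 0) ∷ (# 10 , # 4) ∷ (# 3 , # 7) ∷ (# 5 , # 1) ∷ (# 5 , # 6) ∷ []) ∷
    ((# 0 , # 0) ∷ (# 0 , # 0) ∷ (# 7 , # 2) ∷ (# 0 , # 0) ∷ (# 0 , # 0) ∷ (# 0 , # 0) ∷ (# 0 , # 0) ∷ (# 0 , # 0) ∷ (# 1 , # 0) ∷ (# 0 , # 0) ∷ (# 0 , # 0) ∷ (# 0 , # 0) ∷ (# 0 , # 0) ∷ (# 0 , # 0) ∷ (# 7 , # 1) ∷ (# 0 , # 0) ∷ (# 0 , # 0) ∷ (# 0 , # 0) ∷ (# 1 , # 5) ∷ (# 10 , # 4) ∷ (# 0 , # 0) ∷ (# 7 , # 6) ∷ (# 5 , # 5) ∷ (# 1 , # 1) ∷ []) ∷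
    ((# 0 , # 0) ∷ (# 0 , # 0) ∷ (# 0 , # 0) ∷ (# 11 , # 0) ∷ (# 0 , # 0) ∷ (# 0 , # 0) ∷ (# 0 , # 0) ∷ (# 0 , # 0) ∷ (# 0 , # 0) ∷ (# 3 , # 2) ∷ (# 0 , # 0) ∷ (# 0 , # 0) ∷ (# 0 , # 0) ∷ (# 0 , # 0) ∷ (# 0 , # 0) ∷ (# 11 , # 1) ∷ (# 0 , # 0) ∷ (# 0 , # 0) ∷ (# 3 , # 3) ∷ (# 3 , # 7) ∷ (# 7 , # 6) ∷ (# 0 , # 0) ∷ (# 11 , # 5) ∷ (# 1 , # 6) ∷ []) ∷
    ((# 0 , # 0) ∷ (# 0 , # 0) ∷ (# 0 , # 0) ∷ (# 0 , # 0) ∷ (# 8 , # 1) ∷ (# 0 , # 0) ∷ (# 0 , # 0) ∷ (# 0 , # 0) ∷ (# 0 , # 0) ∷ (# 0 , # 0) ∷ (# 5 , # 0) ∷ (# 0 , # 0) ∷ (# 0 , # 0) ∷ (# 0 , # 0) ∷ (# 0 , # 0) ∷ (# 0 , # 0) ∷ (# 8 , # 0) ∷ (# 0 , # 0) ∷ (# 3 , # 4) ∷ (# 5 , # 1) ∷ (# 5 , # 5) ∷ (# 11 , # 5) ∷ (# 0 , # 0) ∷ (# 8 , # 5) ∷ []) ∷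
    ((# 0 , # 0) ∷ (# 0 , # 0) ∷ (# 0 , # 0) ∷ (# 0 , # 0) ∷ (# 0 , # 0) ∷ (# 9 , # 2) ∷ (# 0 , # 0) ∷ (# 0 , # 0) ∷ (# 0 , # 0) ∷ (# 0 , # 0) ∷ (# 0 , # 0) ∷ (# 1 , # 2) ∷ (# 0 , # 0) ∷ (# 0 , # 0) ∷ (# 0 , # 0) ∷ (# 0 , # 0) ∷ (# 0 , # 0) ∷ (# 9 , # 3) ∷ (# 9 , # 7) ∷ (# 5 , # 6) ∷ (# 1 , # 1) ∷ (# 1 , # 6) ∷ (# 8 , # 5) ∷ (# 0 , # 0) ∷ []) ∷
    []

K₄□K₁₀ : Decomposable (K 4 □ K 10)
K₄□K₁₀ = RookCertificate.verified 4 10 copies owners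
  where
  copies : Vec (Vec (Fin 4 × Fin 10) 8) 30
  copies =
    ((# 0 , # 0) ∷ (# 2 , # 0) ∷ (# 2 , # 1) ∷ (# 0 , # 1) ∷ (# 0 , # 7) ∷ (# 2 , # 7) ∷ (# 1 , # 1) ∷ (# 3 , # 1) ∷ []) ∷
    ((# 1 , # 2) ∷ (# 3 , # 2) ∷ (# 3 , # 3) ∷ (# 1 , # 3) ∷ (# 1 , # 9) ∷ (# 3 , # 9) ∷ (# 2 , # 3) ∷ (# 0 , # 3) ∷ []) ∷
    ((# 2 , # 4) ∷ (# 0 , # 4) ∷ (# 0 , # 5) ∷ (# 2 , # 5) ∷ (# 2 , # 1) ∷ (# 0 , # 1) ∷ (# 3 , # 5) ∷ (# 1 , # 5) ∷ []) ∷
    ((# 3 , # 6) ∷ (# 1 , # 6) ∷ (# 1 , # 7) ∷ (# 3 , # 7) ∷ (# 3 , # 3) ∷ (# 1 , # 3) ∷ (# 0 , # 7) ∷ (# 2 , # 7) ∷ []) ∷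
    ((# 0 , # 8) ∷ (# 2 , # 8) ∷ (# 2 , # 9) ∷ (# 0 , # 9) ∷ (# 0 , # 5) ∷ (# 2 , # 5) ∷ (# 1 , # 9) ∷ (# 3 , # 9) ∷ []) ∷
    ((# 1 , # 0) ∷ (# 3 , # 0) ∷ (# 3 , # 1) ∷ (# 1 , # 1) ∷ (# 1 , # 7) ∷ (# 3 , # 7) ∷ (# 2 , # 1) ∷ (# 0 , # 1) ∷ []) ∷
    ((# 2 , # 2) ∷ (# 0 , # 2) ∷ (# 0 , # 3) ∷ (# 2 , # 3) ∷ (# 2 , # 9) ∷ (# 0 , # 9) ∷ (# 3 , # 3) ∷ (# 1 , # 3) ∷ []) ∷
    ((# 3 , # 4) ∷ (# 1 , # 4) ∷ (# 1 , # 5) ∷ (# 3 , # 5) ∷ (# 3 , # 1) ∷ (# 1 , # 1) ∷ (# 0 , # 5) ∷ (# 2 , # 5) ∷ []) ∷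
    ((# 0 , # 6) ∷ (# 2 , # 6) ∷ (# 2 , # 7) ∷ (# 0 , # 7) ∷ (# 0 , # 3) ∷ (# 2 , # 3) ∷ (# 1 , # 7) ∷ (# 3 , # 7) ∷ []) ∷
    ((# 1 , # 8) ∷ (# 3 , # 8) ∷ (# 3 , # 9) ∷ (# 1 , # 9) ∷ (# 1 , # 5) ∷ (# 3 , # 5) ∷ (# 2 , # 9) ∷ (# 0 , # 9) ∷ []) ∷
    ((# 0 , # 0) ∷ (# 0 , # 4) ∷ (# 0 , # 7) ∷ (# 0 , # 9) ∷ (# 3 , # 0) ∷ (# 0 , # 6) ∷ (# 0 , # 2) ∷ (# 0 , # 3) ∷ []) ∷
    ((# 1 , # 2) ∷ (# 1 , # 6) ∷ (# 1 , # 9) ∷ (# 1 , # 1) ∷ (# 0 , # 2) ∷ (# 1 , # 8) ∷ (# 1 , # 4) ∷ (# 1 , # 5) ∷ []) ∷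
    ((# 2 , # 4) ∷ (# 2 , # 8) ∷ (# 2 , # 1) ∷ (# 2 , # 3) ∷ (# 1 , # 4) ∷ (# 2 , # 0) ∷ (# 2 , # 6) ∷ (# 2 , # 7) ∷ []) ∷
    ((# 3 , # 6) ∷ (# 3 , # 0) ∷ (# 3 , # 3) ∷ (# 3 , # 5) ∷ (# 2 , # 6) ∷ (# 3 , # 2) ∷ (# 3 , # 8) ∷ (# 3 , # 9) ∷ []) ∷
    ((# 0 , # 8) ∷ (# 0 , # 2) ∷ (# 0 , # 5) ∷ (# 0 , # 7) ∷ (# 3 , # 8) ∷ (# 0 , # 4) ∷ (# 0 , # 0) ∷ (# 0 , # 1) ∷ []) ∷
    ((# 1 , # 0) ∷ (# 1 , # 4) ∷ (# 1 , # 7) ∷ (# 1 , # 9) ∷ (# 0 , # 0) ∷ (# 1 , # 6) ∷ (# 1 , # 2) ∷ (# 1 , # 3) ∷ []) ∷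
    ((# 2 , # 2) ∷ (# 2 , # 6) ∷ (# 2 , # 9) ∷ (# 2 , # 1) ∷ (# 1 , # 2) ∷ (# 2 , # 8) ∷ (# 2 , # 4) ∷ (# 2 , # 5) ∷ []) ∷
    ((# 3 , # 4) ∷ (# 3 , # 8) ∷ (# 3 , # 1) ∷ (# 3 , # 3) ∷ (# 2 , # 4) ∷ (# 3 , # 0) ∷ (# 3 , # 6) ∷ (# 3 , # 7) ∷ []) ∷
    ((# 0 , # 6) ∷ (# 0 , # 0) ∷ (# 0 , # 3) ∷ (# 0 , # 5) ∷ (# 3 , # 6) ∷ (# 0 , # 2) ∷ (# 0 , # 8) ∷ (# 0 , # 9) ∷ []) ∷
    ((# 1 , # 8) ∷ (# 1 , # 2) ∷ (# 1 , # 5) ∷ (# 1 , # 7) ∷ (# 0 , # 8) ∷ (# 1 , # 4) ∷ (# 1 , # 0) ∷ (# 1 , # 1) ∷ []) ∷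
    ((# 2 , # 0) ∷ (# 2 , # 4) ∷ (# 2 , # 7) ∷ (# 2 , # 9) ∷ (# 1 , # 0) ∷ (# 2 , # 6) ∷ (# 2 , # 2) ∷ (# 2 , # 3) ∷ []) ∷
    ((# 3 , # 2) ∷ (# 3 , # 6) ∷ (# 3 , # 9) ∷ (# 3 , # 1) ∷ (# 2 , # 2) ∷ (# 3 , # 8) ∷ (# 3 , # 4) ∷ (# 3 , # 5) ∷ []) ∷
    ((# 0 , # 4) ∷ (# 0 , # 8) ∷ (# 0 , # 1) ∷ (# 0 , # 3) ∷ (# 3 , # 4) ∷ (# 0 , # 0) ∷ (# 0 , # 6) ∷ (# 0 , # 7) ∷ []) ∷
    ((# 1 , # 6) ∷ (# 1 , # 0) ∷ (# 1 , # 3) ∷ (# 1 , # 5) ∷ (# 0 , # 6) ∷ (# 1 , # 2) ∷ (# 1 , # 8) ∷ (# 1 , # 9) ∷ []) ∷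
    ((# 2 , # 8) ∷ (# 2 , # 2) ∷ (# 2 , # 5) ∷ (# 2 , # 7) ∷ (# 1 , # 8) ∷ (# 2 , # 4) ∷ (# 2 , # 0) ∷ (# 2 , # 1) ∷ []) ∷
    ((# 3 , # 0) ∷ (# 3 , # 4) ∷ (# 3 , # 7) ∷ (# 3 , # 9) ∷ (# 2 , # 0) ∷ (# 3 , # 6) ∷ (# 3 , # 2) ∷ (# 3 , # 3) ∷ []) ∷
    ((# 0 , # 2) ∷ (# 0 , # 6) ∷ (# 0 , # 9) ∷ (# 0 , # 1) ∷ (# 3 , # 2) ∷ (# 0 , # 8) ∷ (# 0 , # 4) ∷ (# 0 , # 5) ∷ []) ∷
    ((# 1 , # 4) ∷ (# 1 , # 8) ∷ (# 1 , # 1) ∷ (# 1 , # 3) ∷ (# 0 , # 4) ∷ (# 1 , # 0) ∷ (# 1 , # 6) ∷ (# 1 , # 7) ∷ []) ∷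
    ((# 2 , # 6) ∷ (# 2 , # 0) ∷ (# 2 , # 3) ∷ (# 2 , # 5) ∷ (# 1 , # 6) ∷ (# 2 , # 2) ∷ (# 2 , # 8) ∷ (# 2 , # 9) ∷ []) ∷
    ((# 3 , # 8) ∷ (# 3 , # 2) ∷ (# 3 , # 5) ∷ (# 3 , # 7) ∷ (# 2 , # 8) ∷ (# 3 , # 4) ∷ (# 3 , # 0) ∷ (# 3 , # 1) ∷ []) ∷
    []
  owners : Vec (Vec (Fin 30 × Fin 8) 40) 40
  owners =
    ((# 0 , # 0) ∷ (# 0 , # 3) ∷ (# 18 , # 5) ∷ (# 18 , # 1) ∷ (# 10 , # 0) ∷ (# 14 , # 6) ∷ (# 18 , # 0) ∷ (# 0 , # 4) ∷ (# 22 , # 5) ∷ (# 10 , # 3) ∷ (# 15 , # 4) ∷ (# 0 , # 0) ∷ (# 0 , # 0) ∷ (# 0 , # 0) ∷ (# 0 , # 0) ∷ (# 0 , # 0) ∷ (# 0 , # 0) ∷ (# 0 , # 0) ∷ (# 0 , # 0) ∷ (# 0 , # 0) ∷ (# 0 , # 0) ∷ (# 0 , # 0) ∷ (# 0 , # 0) ∷ (# 0 , # 0) ∷ (# 0 , # 0) ∷ (# 0 , # 0) ∷ (# 0 , # 0) ∷ (# 0 , # 0) ∷ (# 0 , # 0) ∷ (# 0 , # 0) ∷ (# 10 , # 4) ∷ (# 0 , # 0) ∷ (# 0 , # 0) ∷ (# 0 , # 0) ∷ (# 0 , # 0) ∷ (# 0 , # 0) ∷ (# 0 , # 0) ∷ (#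 0 , # 0) ∷ (# 0 , # 0) ∷ (# 0 , # 0) ∷ []) ∷
    ((# 0 , # 3) ∷ (# 0 , # 0) ∷ (# 26 , # 3) ∷ (# 22 , # 2) ∷ (# 2 , # 5) ∷ (# 26 , # 7) ∷ (# 22 , # 6) ∷ (# 14 , # 7) ∷ (# 22 , # 1) ∷ (# 26 , # 2) ∷ (# 0 , # 0) ∷ (# 5 , # 7) ∷ (# 0 , # 0) ∷ (# 0 , # 0) ∷ (# 0 , # 0) ∷ (# 0 , # 0) ∷ (# 0 , # 0) ∷ (# 0 , # 0) ∷ (# 0 , # 0) ∷ (# 0 , # 0) ∷ (# 0 , # 0) ∷ (# 0 , # 2) ∷ (# 0 , # 0) ∷ (# 0 , # 0) ∷ (# 0 , # 0) ∷ (# 0 , # 0) ∷ (# 0 , # 0) ∷ (# 0 , # 0) ∷ (# 0 , # 0) ∷ (# 0 , # 0) ∷ (# 0 , # 0) ∷ (# 0 , # 7) ∷ (# 0 , # 0) ∷ (# 0 , # 0) ∷ (# 0 , # 0) ∷ (# 0 , # 0) ∷ (# 0 , # 0) ∷ (# 0 , # 0) ∷ (# 0 , # 0) ∷ (# 0 , # 0) ∷ []) ∷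
    ((# 18 , # 5) ∷ (# 26 , # 3) ∷ (# 0 , # 0) ∷ (# 6 , # 1) ∷ (# 14 , # 5) ∷ (# 14 , # 1) ∷ (# 26 , # 0) ∷ (# 10 , # 6) ∷ (# 14 , # 0) ∷ (# 6 , # 5) ∷ (# 0 , # 0) ∷ (# 0 , # 0) ∷ (# 11 , # 4) ∷ (# 0 , # 0) ∷ (# 0 , # 0) ∷ (# 0 , # 0) ∷ (# 0 , # 0) ∷ (# 0 , # 0) ∷ (# 0 , # 0) ∷ (# 0 , # 0) ∷ (# 0 , # 0) ∷ (# 0 , # 0) ∷ (# 6 , # 0) ∷ (# 0 , # 0) ∷ (# 0 , # 0) ∷ (# 0 , # 0) ∷ (# 0 , # 0) ∷ (# 0 , # 0) ∷ (# 0 , # 0) ∷ (# 0 , # 0) ∷ (# 0 , # 0) ∷ (# 0 , # 0) ∷ (# 26 , # 4) ∷ (# 0 , # 0) ∷ (# 0 , # 0) ∷ (# 0 , # 0) ∷ (# 0 , # 0) ∷ (# 0 , # 0) ∷ (# 0 , # 0) ∷ (# 0 , # 0) ∷ []) ∷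
    ((# 18 , # 1) ∷ (# 22 , # 2) ∷ (# 6 , # 1) ∷ (# 0 , # 0) ∷ (# 22 , # 3) ∷ (# 18 , # 2) ∷ (# 8 , # 4) ∷ (# 22 , # 7) ∷ (# 18 , # 6) ∷ (# 10 , # 7) ∷ (# 0 , # 0) ∷ (# 0 , # 0) ∷ (# 0 , # 0) ∷ (# 1 , # 7) ∷ (# 0 , # 0) ∷ (# 0 , # 0) ∷ (# 0 , # 0) ∷ (# 0 , # 0) ∷ (# 0 , # 0) ∷ (# 0 , # 0) ∷ (# 0 , # 0) ∷ (# 0 , # 0) ∷ (# 0 , # 0) ∷ (# 6 , # 2) ∷ (# 0 , # 0) ∷ (# 0 , # 0) ∷ (# 0 , # 0) ∷ (# 0 , # 0) ∷ (# 0 , # 0) ∷ (# 0 , # 0) ∷ (# 0 , # 0) ∷ (# 0 , # 0) ∷ (# 0 , # 0) ∷ (# 6 , # 6) ∷ (# 0 , # 0) ∷ (# 0 , # 0) ∷ (# 0 , # 0) ∷ (# 0 , # 0) ∷ (# 0 , # 0) ∷ (# 0 , # 0) ∷ []) ∷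
    ((# 10 , # 0) ∷ (# 2 , # 5) ∷ (# 14 , # 5) ∷ (# 22 , # 3) ∷ (# 0 , # 0) ∷ (# 2 , # 1) ∷ (# 10 , # 5) ∷ (# 10 , # 1) ∷ (# 22 , # 0) ∷ (# 26 , # 6) ∷ (# 0 , # 0) ∷ (# 0 , # 0) ∷ (# 0 , # 0) ∷ (# 0 , # 0) ∷ (# 27 , # 4) ∷ (# 0 , # 0) ∷ (# 0 , # 0) ∷ (# 0 , # 0) ∷ (# 0 , # 0) ∷ (# 0 , # 0) ∷ (# 0 , # 0) ∷ (# 0 , # 0) ∷ (# 0 , # 0) ∷ (# 0 , # 0) ∷ (# 2 , # 0) ∷ (# 0 , # 0) ∷ (# 0 , # 0) ∷ (# 0 , # 0) ∷ (# 0 , # 0) ∷ (# 0 , # 0) ∷ (# 0 , # 0) ∷ (# 0 , # 0) ∷ (# 0 , # 0) ∷ (# 0 , # 0) ∷ (# 22 , # 4) ∷ (# 0 , # 0) ∷ (# 0 , # 0) ∷ (# 0 , # 0) ∷ (# 0 , # 0) ∷ (# 0 , # 0) ∷ []) ∷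
    ((# 14 , # 6) ∷ (# 26 , # 7) ∷ (# 14 , # 1) ∷ (# 18 , # 2) ∷ (# 2 , # 1) ∷ (# 0 , # 0) ∷ (# 18 , # 3) ∷ (# 14 , # 2) ∷ (# 4 , # 4) ∷ (# 18 , # 7) ∷ (# 0 , # 0) ∷ (# 0 , # 0) ∷ (# 0 , # 0) ∷ (# 0 , # 0) ∷ (# 0 , # 0) ∷ (# 7 , # 6) ∷ (# 0 , # 0) ∷ (# 0 , # 0) ∷ (# 0 , # 0) ∷ (# 0 , # 0) ∷ (# 0 , # 0) ∷ (# 0 , # 0) ∷ (# 0 , # 0) ∷ (# 0 , # 0) ∷ (# 0 , # 0) ∷ (# 2 , # 2) ∷ (# 0 , # 0) ∷ (# 0 , # 0) ∷ (# 0 , # 0) ∷ (# 0 , # 0) ∷ (# 0 , # 0) ∷ (# 0 , # 0) ∷ (# 0 , # 0) ∷ (# 0 , # 0) ∷ (# 0 , # 0) ∷ (# 2 , # 6) ∷ (# 0 , # 0) ∷ (# 0 , # 0) ∷ (# 0 , # 0) ∷ (# 0 , # 0) ∷ []) ∷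
    ((# 18 , # 0) ∷ (# 22 , # 6) ∷ (# 26 , # 0) ∷ (# 8 , # 4) ∷ (# 10 , # 5) ∷ (# 18 , # 3) ∷ (# 0 , # 0) ∷ (# 8 , # 3) ∷ (# 26 , # 5) ∷ (# 26 , # 1) ∷ (# 0 , # 0) ∷ (# 0 , # 0) ∷ (# 0 , # 0) ∷ (# 0 , # 0) ∷ (# 0 , # 0) ∷ (# 0 , # 0) ∷ (# 23 , # 4) ∷ (# 0 , # 0) ∷ (# 0 , # 0) ∷ (# 0 , # 0) ∷ (# 0 , # 0) ∷ (# 0 , # 0) ∷ (# 0 , # 0) ∷ (# 0 , # 0) ∷ (# 0 , # 0) ∷ (# 0 , # 0) ∷ (# 8 , # 0) ∷ (# 0 , # 0) ∷ (# 0 , # 0) ∷ (# 0 , # 0) ∷ (# 0 , # 0) ∷ (# 0 , # 0) ∷ (# 0 , # 0) ∷ (# 0 , # 0) ∷ (# 0 , # 0) ∷ (# 0 , # 0) ∷ (# 18 , # 4) ∷ (# 0 , # 0) ∷ (# 0 , # 0) ∷ (# 0 , # 0) ∷ []) ∷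
    ((# 0 , # 4) ∷ (# 14 , # 7) ∷ (# 10 , # 6) ∷ (# 22 , # 7) ∷ (# 10 , # 1) ∷ (# 14 , # 2) ∷ (# 8 , # 3) ∷ (# 0 , # 0) ∷ (# 14 , # 3) ∷ (# 10 , # 2) ∷ (# 0 , # 0) ∷ (# 0 , # 0) ∷ (# 0 , # 0) ∷ (# 0 , # 0) ∷ (# 0 , # 0) ∷ (# 0 , # 0) ∷ (# 0 , # 0) ∷ (# 3 , # 6) ∷ (# 0 , # 0) ∷ (# 0 , # 0) ∷ (# 0 , # 0) ∷ (# 0 , # 0) ∷ (# 0 , # 0) ∷ (# 0 , # 0) ∷ (# 0 , # 0) ∷ (# 0 , # 0) ∷ (# 0 , # 0) ∷ (# 8 , # 2) ∷ (# 0 , # 0) ∷ (# 0 , # 0) ∷ (# 0 , # 0) ∷ (# 0 , # 0) ∷ (# 0 , # 0) ∷ (# 0 , # 0) ∷ (# 0 , # 0) ∷ (# 0 , # 0) ∷ (# 0 , # 0) ∷ (# 8 , # 7) ∷ (# 0 , # 0) ∷ (# 0 , # 0) ∷ []) ∷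
    ((# 22 , # 5) ∷ (# 22 , # 1) ∷ (# 14 , # 0) ∷ (# 18 , # 6) ∷ (# 22 , # 0) ∷ (# 4 , # 4) ∷ (# 26 , # 5) ∷ (# 14 , # 3) ∷ (# 0 , # 0) ∷ (# 4 , # 3) ∷ (# 0 , # 0) ∷ (# 0 , # 0) ∷ (# 0 , # 0) ∷ (# 0 , # 0) ∷ (# 0 , # 0) ∷ (# 0 , # 0) ∷ (# 0 , # 0) ∷ (# 0 , # 0) ∷ (# 19 , # 4) ∷ (# 0 , # 0) ∷ (# 0 , # 0) ∷ (# 0 , # 0) ∷ (# 0 , # 0) ∷ (# 0 , # 0) ∷ (# 0 , # 0) ∷ (# 0 , # 0) ∷ (# 0 , # 0) ∷ (# 0 , # 0) ∷ (# 4 , # 0) ∷ (# 0 , # 0) ∷ (# 0 , # 0) ∷ (# 0 , # 0) ∷ (# 0 , # 0) ∷ (# 0 , # 0) ∷ (# 0 , # 0) ∷ (# 0 , # 0) ∷ (# 0 , # 0) ∷ (# 0 , # 0) ∷ (# 14 , # 4) ∷ (# 0 , # 0) ∷ []) ∷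
    ((# 10 , # 3) ∷ (# 26 , # 2) ∷ (# 6 , # 5) ∷ (# 10 , # 7) ∷ (# 26 , # 6) ∷ (# 18 , # 7) ∷ (# 26 , # 1) ∷ (# 10 , # 2) ∷ (# 4 , # 3) ∷ (# 0 , # 0) ∷ (# 0 , # 0) ∷ (# 0 , # 0) ∷ (# 0 , # 0) ∷ (# 0 , # 0) ∷ (# 0 , # 0) ∷ (# 0 , # 0) ∷ (# 0 , # 0) ∷ (# 0 , # 0) ∷ (# 0 , # 0) ∷ (# 9 , # 7) ∷ (# 0 , # 0) ∷ (# 0 , # 0) ∷ (# 0 , # 0) ∷ (# 0 , # 0) ∷ (# 0 , # 0) ∷ (# 0 , # 0) ∷ (# 0 , # 0) ∷ (# 0 , # 0) ∷ (# 0 , # 0) ∷ (# 4 , # 2) ∷ (# 0 , # 0) ∷ (# 0 , # 0) ∷ (# 0 , # 0) ∷ (# 0 , # 0) ∷ (# 0 , # 0) ∷ (# 0 , # 0) ∷ (# 0 , # 0) ∷ (# 0 , # 0) ∷ (# 0 , # 0) ∷ (# 4 , # 7) ∷ []) ∷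
    ((# 15 , # 4) ∷ (# 0 , # 0) ∷ (# 0 , # 0) ∷ (# 0 , # 0) ∷ (# 0 , # 0) ∷ (# 0 , # 0) ∷ (# 0 , # 0) ∷ (# 0 , # 0) ∷ (# 0 , # 0) ∷ (# 0 , # 0) ∷ (# 0 , # 0) ∷ (# 5 , # 3) ∷ (# 23 , # 5) ∷ (# 23 , # 1) ∷ (# 15 , # 0) ∷ (# 19 , # 6) ∷ (# 23 , # 0) ∷ (# 5 , # 4) ∷ (# 27 , # 5) ∷ (# 15 , # 3) ∷ (# 20 , # 4) ∷ (# 0 , # 0) ∷ (# 0 , # 0) ∷ (# 0 , # 0) ∷ (# 0 , # 0) ∷ (# 0 , # 0) ∷ (# 0 , # 0) ∷ (# 0 , # 0) ∷ (# 0 , # 0) ∷ (# 0 , # 0) ∷ (# 5 , # 0) ∷ (# 0 , # 0) ∷ (# 0 , # 0) ∷ (# 0 , # 0) ∷ (# 0 , # 0) ∷ (# 0 , # 0) ∷ (# 0 , # 0) ∷ (# 0 , # 0) ∷ (# 0 , # 0) ∷ (# 0 , # 0) ∷ []) ∷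
    ((# 0 , # 0) ∷ (# 5 , # 7) ∷ (# 0 , # 0) ∷ (# 0 , # 0) ∷ (# 0 , # 0) ∷ (# 0 , # 0) ∷ (# 0 , # 0) ∷ (# 0 , # 0) ∷ (# 0 , # 0) ∷ (# 0 , # 0) ∷ (# 5 , # 3) ∷ (# 0 , # 0) ∷ (# 11 , # 3) ∷ (# 27 , # 2) ∷ (# 7 , # 5) ∷ (# 11 , # 7) ∷ (# 27 , # 6) ∷ (# 19 , # 7) ∷ (# 27 , # 1) ∷ (# 11 , # 2) ∷ (# 0 , # 0) ∷ (# 0 , # 6) ∷ (# 0 , # 0) ∷ (# 0 , # 0) ∷ (# 0 , # 0) ∷ (# 0 , # 0) ∷ (# 0 , # 0) ∷ (# 0 , # 0) ∷ (# 0 , # 0) ∷ (# 0 , # 0) ∷ (# 0 , # 0) ∷ (# 5 , # 2) ∷ (# 0 , # 0) ∷ (# 0 , # 0) ∷ (# 0 , # 0) ∷ (# 0 , # 0) ∷ (# 0 , # 0) ∷ (# 0 , # 0) ∷ (# 0 , # 0) ∷ (# 0 , # 0) ∷ []) ∷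
    ((# 0 , # 0) ∷ (# 0 , # 0) ∷ (# 11 , # 4) ∷ (# 0 , # 0) ∷ (# 0 , # 0) ∷ (# 0 , # 0) ∷ (# 0 , # 0) ∷ (# 0 , # 0) ∷ (# 0 , # 0) ∷ (# 0 , # 0) ∷ (# 23 , # 5) ∷ (# 11 , # 3) ∷ (# 0 , # 0) ∷ (# 1 , # 3) ∷ (# 19 , # 5) ∷ (# 19 , # 1) ∷ (# 11 , # 0) ∷ (# 15 , # 6) ∷ (# 19 , # 0) ∷ (# 1 , # 4) ∷ (# 0 , # 0) ∷ (# 0 , # 0) ∷ (# 16 , # 4) ∷ (# 0 , # 0) ∷ (# 0 , # 0) ∷ (# 0 , # 0) ∷ (# 0 , # 0) ∷ (# 0 , # 0) ∷ (# 0 , # 0) ∷ (# 0 , # 0) ∷ (# 0 , # 0) ∷ (# 0 , # 0) ∷ (# 1 , # 0) ∷ (# 0 , # 0) ∷ (# 0 , # 0) ∷ (# 0 , # 0) ∷ (# 0 , # 0) ∷ (# 0 , # 0) ∷ (# 0 , # 0) ∷ (# 0 , # 0) ∷ []) ∷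
    ((# 0 , # 0) ∷ (# 0 , # 0) ∷ (# 0 , # 0) ∷ (# 1 , # 7) ∷ (# 0 , # 0) ∷ (# 0 , # 0) ∷ (# 0 , # 0) ∷ (# 0 , # 0) ∷ (# 0 , # 0) ∷ (# 0 , # 0) ∷ (# 23 , # 1) ∷ (# 27 , # 2) ∷ (# 1 , # 3) ∷ (# 0 , # 0) ∷ (# 27 , # 3) ∷ (# 23 , # 2) ∷ (# 3 , # 5) ∷ (# 27 , # 7) ∷ (# 23 , # 6) ∷ (# 15 , # 7) ∷ (# 0 , # 0) ∷ (# 0 , # 0) ∷ (# 0 , # 0) ∷ (# 6 , # 7) ∷ (# 0 , # 0) ∷ (# 0 , # 0) ∷ (# 0 , # 0) ∷ (# 0 , # 0) ∷ (# 0 , # 0) ∷ (# 0 , # 0) ∷ (# 0 , # 0) ∷ (# 0 , # 0) ∷ (# 0 , # 0) ∷ (# 1 , # 2) ∷ (# 0 , # 0) ∷ (# 0 , # 0) ∷ (# 0 , # 0) ∷ (# 0 , # 0) ∷ (# 0 , # 0) ∷ (# 0 , # 0) ∷ []) ∷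
    ((# 0 , # 0) ∷ (# 0 , # 0) ∷ (# 0 , # 0) ∷ (# 0 , # 0) ∷ (# 27 , # 4) ∷ (# 0 , # 0) ∷ (# 0 , # 0) ∷ (# 0 , # 0) ∷ (# 0 , # 0) ∷ (# 0 , # 0) ∷ (# 15 , # 0) ∷ (# 7 , # 5) ∷ (# 19 , # 5) ∷ (# 27 , # 3) ∷ (# 0 , # 0) ∷ (# 7 , # 1) ∷ (# 15 , # 5) ∷ (# 15 , # 1) ∷ (# 27 , # 0) ∷ (# 11 , # 6) ∷ (# 0 , # 0) ∷ (# 0 , # 0) ∷ (# 0 , # 0) ∷ (# 0 , # 0) ∷ (# 12 , # 4) ∷ (# 0 , # 0) ∷ (# 0 , # 0) ∷ (# 0 , # 0) ∷ (# 0 , # 0) ∷ (# 0 , # 0) ∷ (# 0 , # 0) ∷ (# 0 , # 0) ∷ (# 0 , # 0) ∷ (# 0 , # 0) ∷ (# 7 , # 0) ∷ (# 0 , # 0) ∷ (# 0 , # 0) ∷ (# 0 , # 0) ∷ (# 0 , # 0) ∷ (# 0 , # 0) ∷ []) ∷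
    ((# 0 , # 0) ∷ (# 0 , # 0) ∷ (# 0 , # 0) ∷ (# 0 , # 0) ∷ (# 0 , # 0) ∷ (# 7 , # 6) ∷ (# 0 , # 0) ∷ (# 0 , # 0) ∷ (# 0 , # 0) ∷ (# 0 , # 0) ∷ (# 19 , # 6) ∷ (# 11 , # 7) ∷ (# 19 , # 1) ∷ (# 23 , # 2) ∷ (# 7 , # 1) ∷ (# 0 , # 0) ∷ (# 23 , # 3) ∷ (# 19 , # 2) ∷ (# 9 , # 4) ∷ (# 23 , # 7) ∷ (# 0 , # 0) ∷ (# 0 , # 0) ∷ (# 0 , # 0) ∷ (# 0 , # 0) ∷ (# 0 , # 0) ∷ (# 2 , # 7) ∷ (# 0 , # 0) ∷ (# 0 , # 0) ∷ (# 0 , # 0) ∷ (# 0 , # 0) ∷ (# 0 , # 0) ∷ (# 0 , # 0) ∷ (# 0 , # 0) ∷ (# 0 , # 0) ∷ (# 0 , # 0) ∷ (# 7 , # 2) ∷ (# 0 , # 0) ∷ (# 0 , # 0) ∷ (# 0 , # 0) ∷ (# 0 , # 0) ∷ []) ∷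
    ((# 0 , # 0) ∷ (# 0 , # 0) ∷ (# 0 , # 0) ∷ (# 0 , # 0) ∷ (# 0 , # 0) ∷ (# 0 , # 0) ∷ (# 23 , # 4) ∷ (# 0 , # 0) ∷ (# 0 , # 0) ∷ (# 0 , # 0) ∷ (# 23 , # 0) ∷ (# 27 , # 6) ∷ (# 11 , # 0) ∷ (# 3 , # 5) ∷ (# 15 , # 5) ∷ (# 23 , # 3) ∷ (# 0 , # 0) ∷ (# 3 , # 1) ∷ (# 11 , # 5) ∷ (# 11 , # 1) ∷ (# 0 , # 0) ∷ (# 0 , # 0) ∷ (# 0 , # 0) ∷ (# 0 , # 0) ∷ (# 0 , # 0) ∷ (# 0 , # 0) ∷ (# 28 , # 4) ∷ (# 0 , # 0) ∷ (# 0 , # 0) ∷ (# 0 , # 0) ∷ (# 0 , # 0) ∷ (# 0 , # 0) ∷ (# 0 , # 0) ∷ (# 0 , # 0) ∷ (# 0 , # 0) ∷ (# 0 , # 0) ∷ (# 3 , # 0) ∷ (# 0 , # 0) ∷ (# 0 , # 0) ∷ (# 0 , # 0) ∷ []) ∷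
    ((# 0 , # 0) ∷ (# 0 , # 0) ∷ (# 0 , # 0) ∷ (# 0 , # 0) ∷ (# 0 , # 0) ∷ (# 0 , # 0) ∷ (# 0 , # 0) ∷ (# 3 , # 6) ∷ (# 0 , # 0) ∷ (# 0 , # 0) ∷ (# 5 , # 4) ∷ (# 19 , # 7) ∷ (# 15 , # 6) ∷ (# 27 , # 7) ∷ (# 15 , # 1) ∷ (# 19 , # 2) ∷ (# 3 , # 1) ∷ (# 0 , # 0) ∷ (# 19 , # 3) ∷ (# 15 , # 2) ∷ (# 0 , # 0) ∷ (# 0 , # 0) ∷ (# 0 , # 0) ∷ (# 0 , # 0) ∷ (# 0 , # 0) ∷ (# 0 , # 0) ∷ (# 0 , # 0) ∷ (# 8 , # 6) ∷ (# 0 , # 0) ∷ (# 0 , # 0) ∷ (# 0 , # 0) ∷ (# 0 , # 0) ∷ (# 0 , # 0) ∷ (# 0 , # 0) ∷ (# 0 , # 0) ∷ (# 0 , # 0) ∷ (# 0 , # 0) ∷ (# 3 , # 2) ∷ (# 0 , # 0) ∷ (# 0 , # 0) ∷ []) ∷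
    ((# 0 , # 0) ∷ (# 0 , # 0) ∷ (# 0 , # 0) ∷ (# 0 , # 0) ∷ (# 0 , # 0) ∷ (# 0 , # 0) ∷ (# 0 , # 0) ∷ (# 0 , # 0) ∷ (# 19 , # 4) ∷ (# 0 , # 0) ∷ (# 27 , # 5) ∷ (# 27 , # 1) ∷ (# 19 , # 0) ∷ (# 23 , # 6) ∷ (# 27 , # 0) ∷ (# 9 , # 4) ∷ (# 11 , # 5) ∷ (# 19 , # 3) ∷ (# 0 , # 0) ∷ (# 9 , # 3) ∷ (# 0 , # 0) ∷ (# 0 , # 0) ∷ (# 0 , # 0) ∷ (# 0 , # 0) ∷ (# 0 , # 0) ∷ (# 0 , # 0) ∷ (# 0 , # 0) ∷ (# 0 , # 0) ∷ (# 24 , # 4) ∷ (# 0 , # 0) ∷ (# 0 , # 0) ∷ (# 0 , # 0) ∷ (# 0 , # 0) ∷ (# 0 , # 0) ∷ (# 0 , # 0) ∷ (# 0 , # 0) ∷ (# 0 , # 0) ∷ (# 0 , # 0) ∷ (# 9 , # 0) ∷ (# 0 , # 0) ∷ []) ∷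
    ((# 0 , # 0) ∷ (# 0 , # 0) ∷ (# 0 , # 0) ∷ (# 0 , # 0) ∷ (# 0 , # 0) ∷ (# 0 , # 0) ∷ (# 0 , # 0) ∷ (# 0 , # 0) ∷ (# 0 , # 0) ∷ (# 9 , # 7) ∷ (# 15 , # 3) ∷ (# 11 , # 2) ∷ (# 1 , # 4) ∷ (# 15 , # 7) ∷ (# 11 , # 6) ∷ (# 23 , # 7) ∷ (# 11 , # 1) ∷ (# 15 , # 2) ∷ (# 9 , # 3) ∷ (# 0 , # 0) ∷ (# 0 , # 0) ∷ (# 0 , # 0) ∷ (# 0 , # 0) ∷ (# 0 , # 0) ∷ (# 0 , # 0) ∷ (# 0 , # 0) ∷ (# 0 , # 0) ∷ (# 0 , # 0) ∷ (# 0 , # 0) ∷ (# 4 , # 6) ∷ (# 0 , # 0) ∷ (# 0 , # 0) ∷ (# 0 , # 0) ∷ (# 0 , # 0) ∷ (# 0 , # 0) ∷ (# 0 , # 0) ∷ (# 0 , # 0) ∷ (# 0 , # 0) ∷ (# 0 , # 0) ∷ (# 9 , # 2) ∷ []) ∷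
    ((# 0 , # 0) ∷ (# 0 , # 0) ∷ (# 0 , # 0) ∷ (# 0 , # 0) ∷ (# 0 , # 0) ∷ (# 0 , # 0) ∷ (# 0 , # 0) ∷ (# 0 , # 0) ∷ (# 0 , # 0) ∷ (# 0 , # 0) ∷ (# 20 , # 4) ∷ (# 0 , # 0) ∷ (# 0 , # 0) ∷ (# 0 , # 0) ∷ (# 0 , # 0) ∷ (# 0 , # 0) ∷ (# 0 , # 0) ∷ (# 0 , # 0) ∷ (# 0 , # 0) ∷ (# 0 , # 0) ∷ (# 0 , # 0) ∷ (# 0 , # 1) ∷ (# 28 , # 5) ∷ (# 28 , # 1) ∷ (# 20 , # 0) ∷ (# 24 , # 6) ∷ (# 28 , # 0) ∷ (# 0 , # 5) ∷ (# 12 , # 5) ∷ (# 20 , # 3) ∷ (# 25 , # 4) ∷ (# 0 , # 0) ∷ (# 0 , # 0) ∷ (# 0 , # 0) ∷ (# 0 , # 0) ∷ (# 0 , # 0) ∷ (# 0 , # 0) ∷ (# 0 , # 0) ∷ (# 0 , # 0) ∷ (# 0 , # 0) ∷ []) ∷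
    ((# 0 , # 0) ∷ (# 0 , # 2) ∷ (# 0 , # 0) ∷ (# 0 , # 0) ∷ (# 0 , # 0) ∷ (# 0 , # 0) ∷ (# 0 , # 0) ∷ (# 0 , # 0) ∷ (# 0 , # 0) ∷ (# 0 , # 0) ∷ (# 0 , # 0) ∷ (# 0 , # 6) ∷ (# 0 , # 0) ∷ (# 0 , # 0) ∷ (# 0 , # 0) ∷ (# 0 , # 0) ∷ (# 0 , # 0) ∷ (# 0 , # 0) ∷ (# 0 , # 0) ∷ (# 0 , # 0) ∷ (# 0 , # 1) ∷ (# 0 , # 0) ∷ (# 16 , # 3) ∷ (# 12 , # 2) ∷ (# 2 , # 4) ∷ (# 16 , # 7) ∷ (# 12 , # 6) ∷ (# 24 , # 7) ∷ (# 12 , # 1) ∷ (# 16 , # 2) ∷ (# 0 , # 0) ∷ (# 5 , # 6) ∷ (# 0 , # 0) ∷ (# 0 , # 0) ∷ (# 0 , # 0) ∷ (# 0 , # 0) ∷ (# 0 , # 0) ∷ (# 0 , # 0) ∷ (# 0 , # 0) ∷ (# 0 , # 0) ∷ []) ∷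
    ((# 0 , # 0) ∷ (# 0 , # 0) ∷ (# 6 , # 0) ∷ (# 0 , # 0) ∷ (# 0 , # 0) ∷ (# 0 , # 0) ∷ (# 0 , # 0) ∷ (# 0 , # 0) ∷ (# 0 , # 0) ∷ (# 0 , # 0) ∷ (# 0 , # 0) ∷ (# 0 , # 0) ∷ (# 16 , # 4) ∷ (# 0 , # 0) ∷ (# 0 , # 0) ∷ (# 0 , # 0) ∷ (# 0 , # 0) ∷ (# 0 , # 0) ∷ (# 0 , # 0) ∷ (# 0 , # 0) ∷ (# 28 , # 5) ∷ (# 16 , # 3) ∷ (# 0 , # 0) ∷ (# 6 , # 3) ∷ (# 24 , # 5) ∷ (# 24 , # 1) ∷ (# 16 , # 0) ∷ (# 20 , # 6) ∷ (# 24 , # 0) ∷ (# 6 , # 4) ∷ (# 0 , # 0) ∷ (# 0 , # 0) ∷ (# 21 , # 4) ∷ (# 0 , # 0) ∷ (# 0 , # 0) ∷ (# 0 , # 0) ∷ (# 0 , # 0) ∷ (# 0 , # 0) ∷ (# 0 , # 0) ∷ (# 0 , # 0) ∷ []) ∷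
    ((# 0 , # 0) ∷ (# 0 , # 0) ∷ (# 0 , # 0) ∷ (# 6 , # 2) ∷ (# 0 , # 0) ∷ (# 0 , # 0) ∷ (# 0 , # 0) ∷ (# 0 , # 0) ∷ (# 0 , # 0) ∷ (# 0 , # 0) ∷ (# 0 , # 0) ∷ (# 0 , # 0) ∷ (# 0 , # 0) ∷ (# 6 , # 7) ∷ (# 0 , # 0) ∷ (# 0 , # 0) ∷ (# 0 , # 0) ∷ (# 0 , # 0) ∷ (# 0 , # 0) ∷ (# 0 , # 0) ∷ (# 28 , # 1) ∷ (# 12 , # 2) ∷ (# 6 , # 3) ∷ (# 0 , # 0) ∷ (# 12 , # 3) ∷ (# 28 , # 2) ∷ (# 8 , # 5) ∷ (# 12 , # 7) ∷ (# 28 , # 6) ∷ (# 20 , # 7) ∷ (# 0 , # 0) ∷ (# 0 , # 0) ∷ (# 0 , # 0) ∷ (# 1 , # 6) ∷ (# 0 , # 0) ∷ (# 0 , # 0) ∷ (# 0 , # 0) ∷ (# 0 , # 0) ∷ (# 0 , # 0) ∷ (# 0 , # 0) ∷ []) ∷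
    ((# 0 , # 0) ∷ (# 0 , # 0) ∷ (# 0 , # 0) ∷ (# 0 , # 0) ∷ (# 2 , # 0) ∷ (# 0 , # 0) ∷ (# 0 , # 0) ∷ (# 0 , # 0) ∷ (# 0 , # 0) ∷ (# 0 , # 0) ∷ (# 0 , # 0) ∷ (# 0 , # 0) ∷ (# 0 , # 0) ∷ (# 0 , # 0) ∷ (# 12 , # 4) ∷ (# 0 , # 0) ∷ (# 0 , # 0) ∷ (# 0 , # 0) ∷ (# 0 , # 0) ∷ (# 0 , # 0) ∷ (# 20 , # 0) ∷ (# 2 , # 4) ∷ (# 24 , # 5) ∷ (# 12 , # 3) ∷ (# 0 , # 0) ∷ (# 2 , # 3) ∷ (# 20 , # 5) ∷ (# 20 , # 1) ∷ (# 12 , # 0) ∷ (# 16 , # 6) ∷ (# 0 , # 0) ∷ (# 0 , # 0) ∷ (# 0 , # 0) ∷ (# 0 , # 0) ∷ (# 17 , # 4) ∷ (# 0 , # 0) ∷ (# 0 , # 0) ∷ (# 0 , # 0) ∷ (# 0 , # 0) ∷ (# 0 , # 0) ∷ []) ∷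
    ((# 0 , # 0) ∷ (# 0 , # 0) ∷ (# 0 , # 0) ∷ (# 0 , # 0) ∷ (# 0 , # 0) ∷ (# 2 , # 2) ∷ (# 0 , # 0) ∷ (# 0 , # 0) ∷ (# 0 , # 0) ∷ (# 0 , # 0) ∷ (# 0 , # 0) ∷ (# 0 , # 0) ∷ (# 0 , # 0) ∷ (# 0 , # 0) ∷ (# 0 , # 0) ∷ (# 2 , # 7) ∷ (# 0 , # 0) ∷ (# 0 , # 0) ∷ (# 0 , # 0) ∷ (# 0 , # 0) ∷ (# 24 , # 6) ∷ (# 16 , # 7) ∷ (# 24 , # 1) ∷ (# 28 , # 2) ∷ (# 2 , # 3) ∷ (# 0 , # 0) ∷ (# 28 , # 3) ∷ (# 24 , # 2) ∷ (# 4 , # 5) ∷ (# 28 , # 7) ∷ (# 0 , # 0) ∷ (# 0 , # 0) ∷ (# 0 , # 0) ∷ (# 0 , # 0) ∷ (# 0 , # 0) ∷ (# 7 , # 7) ∷ (# 0 , # 0) ∷ (# 0 , # 0) ∷ (# 0 , # 0) ∷ (# 0 , # 0) ∷ []) ∷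
    ((# 0 , # 0) ∷ (# 0 , # 0) ∷ (# 0 , # 0) ∷ (# 0 , # 0) ∷ (# 0 , # 0) ∷ (# 0 , # 0) ∷ (# 8 , # 0) ∷ (# 0 , # 0) ∷ (# 0 , # 0) ∷ (# 0 , # 0) ∷ (# 0 , # 0) ∷ (# 0 , # 0) ∷ (# 0 , # 0) ∷ (# 0 , # 0) ∷ (# 0 , # 0) ∷ (# 0 , # 0) ∷ (# 28 , # 4) ∷ (# 0 , # 0) ∷ (# 0 , # 0) ∷ (# 0 , # 0) ∷ (# 28 , # 0) ∷ (# 12 , # 6) ∷ (# 16 , # 0) ∷ (# 8 , # 5) ∷ (# 20 , # 5) ∷ (# 28 , # 3) ∷ (# 0 , # 0) ∷ (# 8 , # 1) ∷ (# 16 , # 5) ∷ (# 16 , # 1) ∷ (# 0 , # 0) ∷ (# 0 , # 0) ∷ (# 0 , # 0) ∷ (# 0 , # 0) ∷ (# 0 , # 0) ∷ (# 0 , # 0) ∷ (# 13 , # 4) ∷ (# 0 , # 0) ∷ (# 0 , # 0) ∷ (# 0 , # 0) ∷ []) ∷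
    ((# 0 , # 0) ∷ (# 0 , # 0) ∷ (# 0 , # 0) ∷ (# 0 , # 0) ∷ (# 0 , # 0) ∷ (# 0 , # 0) ∷ (# 0 , # 0) ∷ (# 8 , # 2) ∷ (# 0 , # 0) ∷ (# 0 , # 0) ∷ (# 0 , # 0) ∷ (# 0 , # 0) ∷ (# 0 , # 0) ∷ (# 0 , # 0) ∷ (# 0 , # 0) ∷ (# 0 , # 0) ∷ (# 0 , # 0) ∷ (# 8 , # 6) ∷ (# 0 , # 0) ∷ (# 0 , # 0) ∷ (# 0 , # 5) ∷ (# 24 , # 7) ∷ (# 20 , # 6) ∷ (# 12 , # 7) ∷ (# 20 , # 1) ∷ (# 24 , # 2) ∷ (# 8 , # 1) ∷ (# 0 , # 0) ∷ (# 24 , # 3) ∷ (# 20 , # 2) ∷ (# 0 , # 0) ∷ (# 0 , # 0) ∷ (# 0 , # 0) ∷ (# 0 , # 0) ∷ (# 0 , # 0) ∷ (# 0 , # 0) ∷ (# 0 , # 0) ∷ (# 3 , # 7) ∷ (# 0 , # 0) ∷ (# 0 , # 0) ∷ []) ∷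
    ((# 0 , # 0) ∷ (# 0 , # 0) ∷ (# 0 , # 0) ∷ (# 0 , # 0) ∷ (# 0 , # 0) ∷ (# 0 , # 0) ∷ (# 0 , # 0) ∷ (# 0 , # 0) ∷ (# 4 , # 0) ∷ (# 0 , # 0) ∷ (# 0 , # 0) ∷ (# 0 , # 0) ∷ (# 0 , # 0) ∷ (# 0 , # 0) ∷ (# 0 , # 0) ∷ (# 0 , # 0) ∷ (# 0 , # 0) ∷ (# 0 , # 0) ∷ (# 24 , # 4) ∷ (# 0 , # 0) ∷ (# 12 , # 5) ∷ (# 12 , # 1) ∷ (# 24 , # 0) ∷ (# 28 , # 6) ∷ (# 12 , # 0) ∷ (# 4 , # 5) ∷ (# 16 , # 5) ∷ (# 24 , # 3) ∷ (# 0 , # 0) ∷ (# 4 , # 1) ∷ (# 0 , # 0) ∷ (# 0 , # 0) ∷ (# 0 , # 0) ∷ (# 0 , # 0) ∷ (# 0 , # 0) ∷ (# 0 , # 0) ∷ (# 0 , # 0) ∷ (# 0 , # 0) ∷ (# 29 , # 4) ∷ (# 0 , # 0) ∷ []) ∷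
    ((# 0 , # 0) ∷ (# 0 , # 0) ∷ (# 0 , # 0) ∷ (# 0 , # 0) ∷ (# 0 , # 0) ∷ (# 0 , # 0) ∷ (# 0 , # 0) ∷ (# 0 , # 0) ∷ (# 0 , # 0) ∷ (# 4 , # 2) ∷ (# 0 , # 0) ∷ (# 0 , # 0) ∷ (# 0 , # 0) ∷ (# 0 , # 0) ∷ (# 0 , # 0) ∷ (# 0 , # 0) ∷ (# 0 , # 0) ∷ (# 0 , # 0) ∷ (# 0 , # 0) ∷ (# 4 , # 6) ∷ (# 20 , # 3) ∷ (# 16 , # 2) ∷ (# 6 , # 4) ∷ (# 20 , # 7) ∷ (# 16 , # 6) ∷ (# 28 , # 7) ∷ (# 16 , # 1) ∷ (# 20 , # 2) ∷ (# 4 , # 1) ∷ (# 0 , # 0) ∷ (# 0 , # 0) ∷ (# 0 , # 0) ∷ (# 0 , # 0) ∷ (# 0 , # 0) ∷ (# 0 , # 0) ∷ (# 0 , # 0) ∷ (# 0 , # 0) ∷ (# 0 , # 0) ∷ (# 0 , # 0) ∷ (# 9 , # 6) ∷ []) ∷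
    ((# 10 , # 4) ∷ (# 0 , # 0) ∷ (# 0 , # 0) ∷ (# 0 , # 0) ∷ (# 0 , # 0) ∷ (# 0 , # 0) ∷ (# 0 , # 0) ∷ (# 0 , # 0) ∷ (# 0 , # 0) ∷ (# 0 , # 0) ∷ (# 5 , # 0) ∷ (# 0 , # 0) ∷ (# 0 , # 0) ∷ (# 0 , # 0) ∷ (# 0 , # 0) ∷ (# 0 , # 0) ∷ (# 0 , # 0) ∷ (# 0 , # 0) ∷ (# 0 , # 0) ∷ (# 0 , # 0) ∷ (# 25 , # 4) ∷ (# 0 , # 0) ∷ (# 0 , # 0) ∷ (# 0 , # 0) ∷ (# 0 , # 0) ∷ (# 0 , # 0) ∷ (# 0 , # 0) ∷ (# 0 , # 0) ∷ (# 0 , # 0) ∷ (# 0 , # 0) ∷ (# 0 , # 0) ∷ (# 5 , # 1) ∷ (# 13 , # 5) ∷ (# 13 , # 1) ∷ (# 25 , # 0) ∷ (# 29 , # 6) ∷ (# 13 , # 0) ∷ (# 5 , # 5) ∷ (# 17 , # 5) ∷ (# 25 , # 3) ∷ []) ∷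
    ((# 0 , # 0) ∷ (# 0 , # 7) ∷ (# 0 , # 0) ∷ (# 0 , # 0) ∷ (# 0 , # 0) ∷ (# 0 , # 0) ∷ (# 0 , # 0) ∷ (# 0 , # 0) ∷ (# 0 , # 0) ∷ (# 0 , # 0) ∷ (# 0 , # 0) ∷ (# 5 , # 2) ∷ (# 0 , # 0) ∷ (# 0 , # 0) ∷ (# 0 , # 0) ∷ (# 0 , # 0) ∷ (# 0 , # 0) ∷ (# 0 , # 0) ∷ (# 0 , # 0) ∷ (# 0 , # 0) ∷ (# 0 , # 0) ∷ (# 5 , # 6) ∷ (# 0 , # 0) ∷ (# 0 , # 0) ∷ (# 0 , # 0) ∷ (# 0 , # 0) ∷ (# 0 , # 0) ∷ (# 0 , # 0) ∷ (# 0 , # 0) ∷ (# 0 , # 0) ∷ (# 5 , # 1) ∷ (# 0 , # 0) ∷ (# 21 , # 3) ∷ (# 17 , # 2) ∷ (# 7 , # 4) ∷ (# 21 , # 7) ∷ (# 17 , # 6) ∷ (# 29 , # 7) ∷ (# 17 , # 1) ∷ (# 21 , # 2) ∷ []) ∷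
    ((# 0 , # 0) ∷ (# 0 , # 0) ∷ (# 26 , # 4) ∷ (# 0 , # 0) ∷ (# 0 , # 0) ∷ (# 0 , # 0) ∷ (# 0 , # 0) ∷ (# 0 , # 0) ∷ (# 0 , # 0) ∷ (# 0 , # 0) ∷ (# 0 , # 0) ∷ (# 0 , # 0) ∷ (# 1 , # 0) ∷ (# 0 , # 0) ∷ (# 0 , # 0) ∷ (# 0 , # 0) ∷ (# 0 , # 0) ∷ (# 0 , # 0) ∷ (# 0 , # 0) ∷ (# 0 , # 0) ∷ (# 0 , # 0) ∷ (# 0 , # 0) ∷ (# 21 , # 4) ∷ (# 0 , # 0) ∷ (# 0 , # 0) ∷ (# 0 , # 0) ∷ (# 0 , # 0) ∷ (# 0 , # 0) ∷ (# 0 , # 0) ∷ (# 0 , # 0) ∷ (# 13 , # 5) ∷ (# 21 , # 3) ∷ (# 0 , # 0) ∷ (# 1 , # 1) ∷ (# 29 , # 5) ∷ (# 29 , # 1) ∷ (# 21 , # 0) ∷ (# 25 , # 6) ∷ (# 29 , # 0) ∷ (# 1 , # 5) ∷ []) ∷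
    ((# 0 , # 0) ∷ (# 0 , # 0) ∷ (# 0 , # 0) ∷ (# 6 , # 6) ∷ (# 0 , # 0) ∷ (# 0 , # 0) ∷ (# 0 , # 0) ∷ (# 0 , # 0) ∷ (# 0 , # 0) ∷ (# 0 , # 0) ∷ (# 0 , # 0) ∷ (# 0 , # 0) ∷ (# 0 , # 0) ∷ (# 1 , # 2) ∷ (# 0 , # 0) ∷ (# 0 , # 0) ∷ (# 0 , # 0) ∷ (# 0 , # 0) ∷ (# 0 , # 0) ∷ (# 0 , # 0) ∷ (# 0 , # 0) ∷ (# 0 , # 0) ∷ (# 0 , # 0) ∷ (# 1 , # 6) ∷ (# 0 , # 0) ∷ (# 0 , # 0) ∷ (# 0 , # 0) ∷ (# 0 , # 0) ∷ (# 0 , # 0) ∷ (# 0 , # 0) ∷ (# 13 , # 1) ∷ (# 17 , # 2) ∷ (# 1 , # 1) ∷ (# 0 , # 0) ∷ (# 17 , # 3) ∷ (# 13 , # 2) ∷ (# 3 , # 4) ∷ (# 17 , # 7) ∷ (# 13 , # 6) ∷ (# 25 , # 7) ∷ []) ∷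
    ((# 0 , # 0) ∷ (# 0 , # 0) ∷ (# 0 , # 0) ∷ (# 0 , # 0) ∷ (# 22 , # 4) ∷ (# 0 , # 0) ∷ (# 0 , # 0) ∷ (# 0 , # 0) ∷ (# 0 , # 0) ∷ (# 0 , # 0) ∷ (# 0 , # 0) ∷ (# 0 , # 0) ∷ (# 0 , # 0) ∷ (# 0 , # 0) ∷ (# 7 , # 0) ∷ (# 0 , # 0) ∷ (# 0 , # 0) ∷ (# 0 , # 0) ∷ (# 0 , # 0) ∷ (# 0 , # 0) ∷ (# 0 , # 0) ∷ (# 0 , # 0) ∷ (# 0 , # 0) ∷ (# 0 , # 0) ∷ (# 17 , # 4) ∷ (# 0 , # 0) ∷ (# 0 , # 0) ∷ (# 0 , # 0) ∷ (# 0 , # 0) ∷ (# 0 , # 0) ∷ (# 25 , # 0) ∷ (# 7 , # 4) ∷ (# 29 , # 5) ∷ (# 17 , # 3) ∷ (# 0 , # 0) ∷ (# 7 , # 3) ∷ (# 25 , # 5) ∷ (# 25 , # 1) ∷ (# 17 , # 0) ∷ (# 21 , # 6) ∷ []) ∷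
    ((# 0 , # 0) ∷ (# 0 , # 0) ∷ (# 0 , # 0) ∷ (# 0 , # 0) ∷ (# 0 , # 0) ∷ (# 2 , # 6) ∷ (# 0 , # 0) ∷ (# 0 , # 0) ∷ (# 0 , # 0) ∷ (# 0 , # 0) ∷ (# 0 , # 0) ∷ (# 0 , # 0) ∷ (# 0 , # 0) ∷ (# 0 , # 0) ∷ (# 0 , # 0) ∷ (# 7 , # 2) ∷ (# 0 , # 0) ∷ (# 0 , # 0) ∷ (# 0 , # 0) ∷ (# 0 , # 0) ∷ (# 0 , # 0) ∷ (# 0 , # 0) ∷ (# 0 , # 0) ∷ (# 0 , # 0) ∷ (# 0 , # 0) ∷ (# 7 , # 7) ∷ (# 0 , # 0) ∷ (# 0 , # 0) ∷ (# 0 , # 0) ∷ (# 0 , # 0) ∷ (# 29 , # 6) ∷ (# 21 , # 7) ∷ (# 29 , # 1) ∷ (# 13 , # 2) ∷ (# 7 , # 3) ∷ (# 0 , # 0) ∷ (# 13 , # 3) ∷ (# 29 , # 2) ∷ (# 9 , # 5) ∷ (# 13 , # 7) ∷ []) ∷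
    ((# 0 , # 0) ∷ (# 0 , # 0) ∷ (# 0 , # 0) ∷ (# 0 , # 0) ∷ (# 0 , # 0) ∷ (# 0 , # 0) ∷ (# 18 , # 4) ∷ (# 0 , # 0) ∷ (# 0 , # 0) ∷ (# 0 , # 0) ∷ (# 0 , # 0) ∷ (# 0 , # 0) ∷ (# 0 , # 0) ∷ (# 0 , # 0) ∷ (# 0 , # 0) ∷ (# 0 , # 0) ∷ (# 3 , # 0) ∷ (# 0 , # 0) ∷ (# 0 , # 0) ∷ (# 0 , # 0) ∷ (# 0 , # 0) ∷ (# 0 , # 0) ∷ (# 0 , # 0) ∷ (# 0 , # 0) ∷ (# 0 , # 0) ∷ (# 0 , # 0) ∷ (# 13 , # 4) ∷ (# 0 , # 0) ∷ (# 0 , # 0) ∷ (# 0 , # 0) ∷ (# 13 , # 0) ∷ (# 17 , # 6) ∷ (# 21 , # 0) ∷ (# 3 , # 4) ∷ (# 25 , # 5) ∷ (# 13 , # 3) ∷ (# 0 , # 0) ∷ (# 3 , # 3) ∷ (# 21 , # 5) ∷ (# 21 , # 1) ∷ []) ∷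
    ((# 0 , # 0) ∷ (# 0 , # 0) ∷ (# 0 , # 0) ∷ (# 0 , # 0) ∷ (# 0 , # 0) ∷ (# 0 , # 0) ∷ (# 0 , # 0) ∷ (# 8 , # 7) ∷ (# 0 , # 0) ∷ (# 0 , # 0) ∷ (# 0 , # 0) ∷ (# 0 , # 0) ∷ (# 0 , # 0) ∷ (# 0 , # 0) ∷ (# 0 , # 0) ∷ (# 0 , # 0) ∷ (# 0 , # 0) ∷ (# 3 , # 2) ∷ (# 0 , # 0) ∷ (# 0 , # 0) ∷ (# 0 , # 0) ∷ (# 0 , # 0) ∷ (# 0 , # 0) ∷ (# 0 , # 0) ∷ (# 0 , # 0) ∷ (# 0 , # 0) ∷ (# 0 , # 0) ∷ (# 3 , # 7) ∷ (# 0 , # 0) ∷ (# 0 , # 0) ∷ (# 5 , # 5) ∷ (# 29 , # 7) ∷ (# 25 , # 6) ∷ (# 17 , # 7) ∷ (# 25 , # 1) ∷ (# 29 , # 2) ∷ (# 3 , # 3) ∷ (# 0 , # 0) ∷ (# 29 , # 3) ∷ (# 25 , # 2) ∷ []) ∷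
    ((# 0 , # 0) ∷ (# 0 , # 0) ∷ (# 0 , # 0) ∷ (# 0 , # 0) ∷ (# 0 , # 0) ∷ (# 0 , # 0) ∷ (# 0 , # 0) ∷ (# 0 , # 0) ∷ (# 14 , # 4) ∷ (# 0 , # 0) ∷ (# 0 , # 0) ∷ (# 0 , # 0) ∷ (# 0 , # 0) ∷ (# 0 , # 0) ∷ (# 0 , # 0) ∷ (# 0 , # 0) ∷ (# 0 , # 0) ∷ (# 0 , # 0) ∷ (# 9 , # 0) ∷ (# 0 , # 0) ∷ (# 0 , # 0) ∷ (# 0 , # 0) ∷ (# 0 , # 0) ∷ (# 0 , # 0) ∷ (# 0 , # 0) ∷ (# 0 , # 0) ∷ (# 0 , # 0) ∷ (# 0 , # 0) ∷ (# 29 , # 4) ∷ (# 0 , # 0) ∷ (# 17 , # 5) ∷ (# 17 , # 1) ∷ (# 29 , # 0) ∷ (# 13 , # 6) ∷ (# 17 , # 0) ∷ (# 9 , # 5) ∷ (# 21 , # 5) ∷ (# 29 , # 3) ∷ (# 0 , # 0) ∷ (# 9 , # 1) ∷ []) ∷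
    ((# 0 , # 0) ∷ (# 0 , # 0) ∷ (# 0 , # 0) ∷ (# 0 , # 0) ∷ (# 0 , # 0) ∷ (# 0 , # 0) ∷ (# 0 , # 0) ∷ (# 0 , # 0) ∷ (# 0 , # 0) ∷ (# 4 , # 7) ∷ (# 0 , # 0) ∷ (# 0 , # 0) ∷ (# 0 , # 0) ∷ (# 0 , # 0) ∷ (# 0 , # 0) ∷ (# 0 , # 0) ∷ (# 0 , # 0) ∷ (# 0 , # 0) ∷ (# 0 , # 0) ∷ (# 9 , # 2) ∷ (# 0 , # 0) ∷ (# 0 , # 0) ∷ (# 0 , # 0) ∷ (# 0 , # 0) ∷ (# 0 , # 0) ∷ (# 0 , # 0) ∷ (# 0 , # 0) ∷ (# 0 , # 0) ∷ (# 0 , # 0) ∷ (# 9 , # 6) ∷ (# 25 , # 3) ∷ (# 21 , # 2) ∷ (# 1 , # 5) ∷ (# 25 , # 7) ∷ (# 21 , # 6) ∷ (# 13 , # 7) ∷ (# 21 , # 1) ∷ (# 25 , # 2) ∷ (# 9 , # 1) ∷ (# 0 , # 0) ∷ []) ∷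
    []

K₄,₄ : Decomposable (Bipartite (Fin 4) (Fin 4))
K₄,₄ = BipartiteCertificate.verified 4 4 copies owners
  where
  copies : Vec (Vec (Fin 4 ⊎ Fin 4) 8) 2
  copies =
    (inj₂ (# 2) ∷ inj₁ (# 1) ∷ inj₂ (# 0) ∷ inj₁ (# 3) ∷ inj₁ (# 2) ∷ inj₂ (# 3) ∷ inj₁ (# 0) ∷ inj₂ (# 1) ∷ []) ∷
    (inj₂ (# 3) ∷ inj₁ (# 2) ∷ inj₂ (# 1) ∷ inj₁ (# 0) ∷ inj₁ (# 3) ∷ inj₂ (# 0) ∷ inj₁ (# 1) ∷ inj₂ (# 2) ∷ []) ∷
    []
  owners : Vec (Vec (Fin 2 × Fin 8) 8) 8
  owners =
    ((# 0 , # 0) ∷ (# 0 , # 0) ∷ (# 0 , # 0) ∷ (# 0 , # 0) ∷ (# 0 , # 6) ∷ (# 1 , # 2) ∷ (# 1 , # 7) ∷ (# 1 , # 3) ∷ []) ∷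
    ((# 0 , # 0) ∷ (# 0 , # 0) ∷ (# 0 , # 0) ∷ (# 0 , # 0) ∷ (# 0 , # 1) ∷ (# 1 , # 6) ∷ (# 0 , # 0) ∷ (# 0 , # 5) ∷ []) ∷
    ((# 0 , # 0) ∷ (# 0 , # 0) ∷ (# 0 , # 0) ∷ (# 0 , # 0) ∷ (# 1 , # 5) ∷ (# 1 , # 1) ∷ (# 0 , # 4) ∷ (# 1 , # 0) ∷ []) ∷
    ((# 0 , # 0) ∷ (# 0 , # 0) ∷ (# 0 , # 0) ∷ (# 0 , # 0) ∷ (# 0 , # 2) ∷ (# 0 , # 7) ∷ (# 0 , # 3) ∷ (# 1 , # 4) ∷ []) ∷
    ((# 0 , # 6) ∷ (# 0 , # 1) ∷ (# 1 , # 5) ∷ (# 0 , # 2) ∷ (# 0 , # 0) ∷ (# 0 , # 0) ∷ (# 0 , # 0) ∷ (# 0 , # 0) ∷ []) ∷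
    ((# 1 , # 2) ∷ (# 1 , # 6) ∷ (# 1 , # 1) ∷ (# 0 , # 7) ∷ (# 0 , # 0) ∷ (# 0 , # 0) ∷ (# 0 , # 0) ∷ (# 0 , # 0) ∷ []) ∷
    ((# 1 , # 7) ∷ (# 0 , # 0) ∷ (# 0 , # 4) ∷ (# 0 , # 3) ∷ (# 0 , # 0) ∷ (# 0 , # 0) ∷ (# 0 , # 0) ∷ (# 0 , # 0) ∷ []) ∷
    ((# 1 , # 3) ∷ (# 0 , # 5) ∷ (# 1 , # 0) ∷ (# 1 , # 4) ∷ (# 0 , # 0) ∷ (# 0 , # 0) ∷ (# 0 , # 0) ∷ (# 0 , # 0) ∷ []) ∷
    []

K₆,₈ : Decomposable (Bipartite (Fin 6) (Fin 8))
K₆,₈ = BipartiteCertificate.verified 6 8 copies owners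
  where
  copies : Vec (Vec (Fin 6 ⊎ Fin 8) 8) 6
  copies =
    (inj₁ (# 4) ∷ inj₂ (# 0) ∷ inj₁ (# 1) ∷ inj₂ (# 6) ∷ inj₂ (# 3) ∷ inj₁ (# 3) ∷ inj₂ (# 4) ∷ inj₁ (# 5) ∷ []) ∷
    (inj₂ (# 0) ∷ inj₁ (# 0) ∷ inj₂ (# 7) ∷ inj₁ (# 2) ∷ inj₁ (# 5) ∷ inj₂ (# 1) ∷ inj₁ (# 4) ∷ inj₂ (# 2) ∷ []) ∷
    (inj₂ (# 6) ∷ inj₁ (# 0) ∷ inj₂ (# 2) ∷ inj₁ (# 3) ∷ inj₁ (# 2) ∷ inj₂ (# 3) ∷ inj₁ (# 4) ∷ inj₂ (# 1) ∷ []) ∷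
    (inj₂ (# 5) ∷ inj₁ (# 5) ∷ inj₂ (# 1) ∷ inj₁ (# 2) ∷ inj₁ (# 0) ∷ inj₂ (# 2) ∷ inj₁ (# 1) ∷ inj₂ (# 4) ∷ []) ∷
    (inj₁ (# 4) ∷ inj₂ (# 5) ∷ inj₁ (# 3) ∷ inj₂ (# 4) ∷ inj₂ (# 1) ∷ inj₁ (# 1) ∷ inj₂ (# 3) ∷ inj₁ (# 0) ∷ []) ∷
    (inj₁ (# 1) ∷ inj₂ (# 3) ∷ inj₁ (# 5) ∷ inj₂ (# 7) ∷ inj₂ (# 2) ∷ inj₁ (# 2) ∷ inj₂ (# 4) ∷ inj₁ (# 3) ∷ []) ∷
    []
  owners : Vec (Vec (Fin 6 × Fin 8) 14) 14
  owners =
    ((# 0 , # 0) ∷ (# 0 , # 0) ∷ (# 0 , # 0) ∷ (# 0 , # 0) ∷ (# 0 , # 0) ∷ (# 0 , # 0) ∷ (# 1 , # 0) ∷ (# 1 , # 5) ∷ (# 2 , # 1) ∷ (# 2 , # 5) ∷ (# 4 , # 7) ∷ (# 3 , # 4) ∷ (# 2 , # 0) ∷ (# 1 , # 1) ∷ []) ∷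
    ((# 0 , # 0) ∷ (# 0 , # 0) ∷ (# 0 , # 0) ∷ (# 0 , # 0) ∷ (# 0 , # 0) ∷ (# 0 , # 0) ∷ (# 0 , # 1) ∷ (# 3 , # 6) ∷ (# 5 , # 4) ∷ (# 5 , # 0) ∷ (# 0 , # 6) ∷ (# 4 , # 5) ∷ (# 0 , # 2) ∷ (# 5 , # 3) ∷ []) ∷
    ((# 0 , # 0) ∷ (# 0 , # 0) ∷ (# 0 , # 0) ∷ (# 0 , # 0) ∷ (# 0 , # 0) ∷ (# 0 , # 0) ∷ (# 1 , # 3) ∷ (# 3 , # 2) ∷ (# 1 , # 7) ∷ (# 5 , # 5) ∷ (# 3 , # 7) ∷ (# 3 , # 3) ∷ (# 2 , # 4) ∷ (# 1 , # 2) ∷ []) ∷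
    ((# 0 , # 0) ∷ (# 0 , # 0) ∷ (# 0 , # 0) ∷ (# 0 , # 0) ∷ (# 0 , # 0) ∷ (# 0 , # 0) ∷ (# 0 , # 5) ∷ (# 2 , # 7) ∷ (# 2 , # 2) ∷ (# 4 , # 6) ∷ (# 4 , # 2) ∷ (# 4 , # 1) ∷ (# 2 , # 3) ∷ (# 5 , # 7) ∷ []) ∷
    ((# 0 , # 0) ∷ (# 0 , # 0) ∷ (# 0 , # 0) ∷ (# 0 , # 0) ∷ (# 0 , # 0) ∷ (# 0 , # 0) ∷ (# 0 , # 0) ∷ (# 4 , # 4) ∷ (# 2 , # 6) ∷ (# 0 , # 4) ∷ (# 4 , # 3) ∷ (# 4 , # 0) ∷ (# 0 , # 3) ∷ (# 1 , # 6) ∷ []) ∷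
    ((# 0 , # 0) ∷ (# 0 , # 0) ∷ (# 0 , # 0) ∷ (# 0 , # 0) ∷ (# 0 , # 0) ∷ (# 0 , # 0) ∷ (# 1 , # 4) ∷ (# 3 , # 1) ∷ (# 3 , # 5) ∷ (# 5 , # 1) ∷ (# 5 , # 6) ∷ (# 3 , # 0) ∷ (# 0 , # 7) ∷ (# 5 , # 2) ∷ []) ∷
    ((# 1 , # 0) ∷ (# 0 , # 1) ∷ (# 1 , # 3) ∷ (# 0 , # 5) ∷ (# 0 , # 0) ∷ (# 1 , # 4) ∷ (# 0 , # 0) ∷ (# 0 , # 0) ∷ (# 0 , # 0) ∷ (# 0 , # 0) ∷ (# 0 , # 0) ∷ (# 0 , # 0) ∷ (# 0 , # 0) ∷ (# 0 , # 0) ∷ []) ∷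
    ((# 1 , # 5) ∷ (# 3 , # 6) ∷ (# 3 , # 2) ∷ (# 2 , # 7) ∷ (# 4 , # 4) ∷ (# 3 , # 1) ∷ (# 0 , # 0) ∷ (# 0 , # 0) ∷ (# 0 , # 0) ∷ (# 0 , # 0) ∷ (# 0 , # 0) ∷ (# 0 , # 0) ∷ (# 0 , # 0) ∷ (# 0 , # 0) ∷ []) ∷
    ((# 2 , # 1) ∷ (# 5 , # 4) ∷ (# 1 , # 7) ∷ (# 2 , # 2) ∷ (# 2 , # 6) ∷ (# 3 , # 5) ∷ (# 0 , # 0) ∷ (# 0 , # 0) ∷ (# 0 , # 0) ∷ (# 0 , # 0) ∷ (# 0 , # 0) ∷ (# 0 , # 0) ∷ (# 0 , # 0) ∷ (# 0 , # 0) ∷ []) ∷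
    ((# 2 , # 5) ∷ (# 5 , # 0) ∷ (# 5 , # 5) ∷ (# 4 , # 6) ∷ (# 0 , # 4) ∷ (# 5 , # 1) ∷ (# 0 , # 0) ∷ (# 0 , # 0) ∷ (# 0 , # 0) ∷ (# 0 , # 0) ∷ (# 0 , # 0) ∷ (# 0 , # 0) ∷ (# 0 , # 0) ∷ (# 0 , # 0) ∷ []) ∷
    ((# 4 , # 7) ∷ (# 0 , # 6) ∷ (# 3 , # 7) ∷ (# 4 , # 2) ∷ (# 4 , # 3) ∷ (# 5 , # 6) ∷ (# 0 , # 0) ∷ (# 0 , # 0) ∷ (# 0 , # 0) ∷ (# 0 , # 0) ∷ (# 0 , # 0) ∷ (# 0 , # 0) ∷ (# 0 , # 0) ∷ (# 0 , # 0) ∷ []) ∷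
    ((# 3 , # 4) ∷ (# 4 , # 5) ∷ (# 3 , # 3) ∷ (# 4 , # 1) ∷ (# 4 , # 0) ∷ (# 3 , # 0) ∷ (# 0 , # 0) ∷ (# 0 , # 0) ∷ (# 0 , # 0) ∷ (# 0 , # 0) ∷ (# 0 , # 0) ∷ (# 0 , # 0) ∷ (# 0 , # 0) ∷ (# 0 , # 0) ∷ []) ∷
    ((# 2 , # 0) ∷ (# 0 , # 2) ∷ (# 2 , # 4) ∷ (# 2 , # 3) ∷ (# 0 , # 3) ∷ (# 0 , # 7) ∷ (# 0 , # 0) ∷ (# 0 , # 0) ∷ (# 0 , # 0) ∷ (# 0 , # 0) ∷ (# 0 , # 0) ∷ (# 0 , # 0) ∷ (# 0 , # 0) ∷ (# 0 , # 0) ∷ []) ∷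
    ((# 1 , # 1) ∷ (# 5 , # 3) ∷ (# 1 , # 2) ∷ (# 5 , # 7) ∷ (# 1 , # 6) ∷ (# 5 , # 2) ∷ (# 0 , # 0) ∷ (# 0 , # 0) ∷ (# 0 , # 0) ∷ (# 0 , # 0) ∷ (# 0 , # 0) ∷ (# 0 , # 0) ∷ (# 0 , # 0) ∷ (# 0 , # 0) ∷ []) ∷
    []

-- Sizes are written as q * 2 and r * 4, so that adding a block of fixed size on
-- the left is a computation: 4 + suc q * 2 and suc (suc (suc q)) * 2 are the
-- same number by definition, and so on.

K₄,₈ : Decomposable (Bipartite (Fin 4) (Fin 8))
K₄,₈ = swapBipartite (partJoinᶠ (swapBipartite K₄,₄) (swapBipartite K₄,₄))

K₂q,₈ : ∀ q → Decomposable (Bipartite (Fin (suc (suc q) * 2)) (Fin 8))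
K₂q,₈ zero          = K₄,₈
K₂q,₈ (suc zero)    = K₆,₈
K₂q,₈ (suc (suc q)) = partJoinᶠ K₄,₈ (K₂q,₈ q)

K₄□K₈ : Decomposable (K 4 □ K 8)
K₄□K₈ = columnJoinᶠ K₄□K₄ K₄□K₄ K₄,₄

-- K_4 □ K_{2s+2} for all s: five base cases, then K_4 □ K_{2s+12} is glued
-- from K_4 □ K_8, K_4 □ K_{2s+4} and K_{8,2s+4}.
K₄□K₂ₛ : ∀ s → Decomposable (K 4 □ K (suc s * 2))
K₄□K₂ₛ 0 = K₄□K₂
K₄□K₂ₛ 1 = K₄□K₄
K₄□K₂ₛ 2 = K₄□K₆
K₄□K₂ₛ 3 = K₄□K₈
K₄□K₂ₛ 4 = K₄□K₁₀
K₄□K₂ₛ (suc (suc (suc (suc (suc s))))) = columnJoinᶠ K₄□K₈ (K₄□K₂ₛ (suc s)) (swapBipartite (K₂q,₈ s))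

K₄ᵣ,₄ : ∀ r → Decomposable (Bipartite (Fin (suc r * 4)) (Fin 4))
K₄ᵣ,₄ zero    = K₄,₄
K₄ᵣ,₄ (suc r) = partJoinᶠ K₄,₄ (K₄ᵣ,₄ r)

K₄ᵣ□Kₙ : ∀ r {n} → Decomposable (K 4 □ K n) → Decomposable (K (suc r * 4) □ K n)
K₄ᵣ□Kₙ zero    D = D
K₄ᵣ□Kₙ (suc r) D = rowJoinᶠ D (K₄ᵣ□Kₙ r D) (swapBipartite (K₄ᵣ,₄ r))

K₄ᵣ□K₂ₛ : ∀ r s → Decomposable (K (suc r * 4) □ K (suc s * 2))
K₄ᵣ□K₂ₛ r s = K₄ᵣ□Kₙ r (K₄□K₂ₛ s)

positive-multiple : ∀ {d m} → 0 < m → d ∣ m → Σ ℕ λ q → m ≡ suc q * d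
positive-multiple ()  (divides zero refl)
positive-multiple _   (divides (suc q) m≡) = q , m≡

lemma2p3 : (m n : ℕ) → 0 < m → 0 < n → 8 ∣ m → 2 ∣ n →
           L8Decomposition (K m □ K n)
lemma2p3 m n 0<m 0<n 8∣m 2∣n =
  let (q , m≡) = positive-multiple 0<m 8∣m
      (s , n≡) = positive-multiple 0<n 2∣n
      -- m = (q + 1) * 8 = (2q + 2) * 4
      m≡′ : m ≡ suc (suc (q * 2)) * 4
      m≡′ = trans m≡ (≡-sym (*-assoc (suc q) 2 4))
  in toL8Decomposition (subst₂ (λ a b → Decomposable (K a □ K b)) (≡-sym m≡′) (≡-sym n≡)
                                (K₄ᵣ□K₂ₛ (suc (q * 2)) s))
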